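{- Fix a positive integer $\ell$, a set $L\subseteq[0,\ell-1]$ and a set $R_0\subseteq[0,\ell-1]$. For an integer $r>2\ell$, let $R=R_0+(r-\ell)\subseteq[r-\ell,r-1]$, let $M$ be a uniformly random subset of $[\ell,r-\ell-1]$, and let $S=L\cup M\cup R$. Let $a$ be the smallest integer such that both $[\ell,2\ell-a]\subseteq L+L$ and $[2r-2\ell+a-2,2r-\ell-2]\subseteq R+R$. Let $\tau(L)=|\{i\in L: i\le \ell-a+1\}|$ and $\tau(R)=|\{i\in R: i\ge r-\ell+a-2\}|$. Then for every $\varepsilon>0$ there exists $r_0$ such that for all $r\ge r_0$, $$\mathbb{P}\big([2\ell-a+1,2r-2\ell+a-3]\subseteq S+S\big)\ \ge\ 1-(a-2)\big(2^{ -\tau(R)}+2^{ -\tau(L)}\big)-6\big(2^{ -|L|}+2^{ -|R|}\big)-\varepsilon.$$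
   Context: For integers $a\le b$, $[a,b]=\{x\in\mathbb{Z}:a\le x\le b\}$ (empty if $a>b$). For a set $A$ of integers, $A+A=\{x+y:x,y\in A\}$ and $A+t=\{x+t:x\in A\}$. "Uniformly random subset" means each subset is equally likely. -}

module Defs where

open import Data.Bool using (Bool; true; false; _∧_; _∨_; if_then_else_)
open import Data.Nat as ℕ using (ℕ; zero; suc)
open import Data.Nat.Properties using (m^n≢0)
open import Data.Integer as ℤ using (ℤ; +_; -[1+_]; _≤ᵇ_)
open import Data.Fin using (Fin; fromℕ<)
open import Data.Fin.Subset using (Subset)
import Data.Fin.Subset
open import Data.Vec using (Vec; []; _∷_; lookup)
open import Data.List using (List; []; _∷_; map; concatMap; foldr; upTo)
open import Data.Bool.ListAction using (any; all)
open import Data.Product using (_×_)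
open import Data.Rational as ℚ using (ℚ)
open import Relation.Nullary using (yes; no; does)
open import Relation.Binary.PropositionalEquality using (_≡_)

ISet : Set
ISet = ℤ → Bool

-- A subset A ⊆ [0,n-1] (a Data.Fin.Subset n) translated by t,
-- i.e. the indicator of  A + t ⊆ [t, t+n-1].
shifted : (n : ℕ) → Subset n → ℤ → ISet
shifted n A t x with x ℤ.- t
... | -[1+ _ ] = false
... | + k with k ℕ.<? n
...   | yes k<n = lookup A (fromℕ< k<n)
...   | no _ = false

_∪_ : ISet → ISet → ISet
(A ∪ B) x = A x ∨ B x

-- Sumset A + A for a set A ⊆ [0,n-1]:  x ∈ A + A  iff  x = i + j with i, j ∈ A.
-- (searching i, j over [0,n-1] is exhaustive because A is supported there)
sumset : (n : ℕ) → ISet → ISet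
sumset n A x =
  any (λ i → any (λ j → A (+ i) ∧ A (+ j) ∧ does ((+ i) ℤ.+ (+ j) ℤ.≟ x)) (upTo n)) (upTo n)

Intv⊆ : ℤ → ℤ → ISet → Set
Intv⊆ a b A = ∀ (x : ℤ) → a ℤ.≤ x → x ℤ.≤ b → A x ≡ true

intvSize : ℤ → ℤ → ℕ
intvSize a b = if a ≤ᵇ b then suc ℤ.∣ b ℤ.- a ∣ else zero

Intv⊆ᵇ : ℤ → ℤ → ISet → Bool
Intv⊆ᵇ a b A = all (λ k → A (a ℤ.+ + k)) (upTo (intvSize a b))

countIn : (n : ℕ) → ISet → (ℤ → Bool) → ℕ
countIn n A P = foldr (λ i c → if A (+ i) ∧ P (+ i) then suc c else c) 0 (upTo n)

allSubsets : (n : ℕ) → List (Subset n)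
allSubsets zero = [] ∷ []
allSubsets (suc n) = concatMap (λ s → (true ∷ s) ∷ (false ∷ s) ∷ []) (allSubsets n)

countSubsets : (n : ℕ) → (Subset n → Bool) → ℕ
countSubsets n E = foldr (λ s c → if E s then suc c else c) 0 (allSubsets n)

Prob : (n : ℕ) → (Subset n → Bool) → ℚ
Prob n E = ℚ._/_ (+ countSubsets n E) (2 ℕ.^ n) {{m^n≢0 2 n}}

pow2neg : ℕ → ℚ
pow2neg k = ℚ._/_ (+ 1) (2 ℕ.^ k) {{m^n≢0 2 k}}

toℚ : ℤ → ℚ
toℚ z = ℚ._/_ z 1

module Setting (ℓ : ℕ) (L R₀ : Subset ℓ) (r : ℕ) where

  ℓℤ rℤ : ℤ
  ℓℤ = + ℓ
  rℤ = + r

  Lset : ISet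
  Lset = shifted ℓ L (+ 0)

  Rset : ISet
  Rset = shifted ℓ R₀ (rℤ ℤ.- ℓℤ)

  -- M ⊆ [ℓ, r-ℓ-1]; a subset of this interval (which has r-2ℓ elements)
  -- is encoded as a Subset (r ∸ 2ℓ) translated by ℓ.
  Mset : Subset (r ℕ.∸ 2 ℕ.* ℓ) → ISet
  Mset M = shifted (r ℕ.∸ 2 ℕ.* ℓ) M ℓℤ

  Sset : Subset (r ℕ.∸ 2 ℕ.* ℓ) → ISet
  Sset M = (Lset ∪ Mset M) ∪ Rset

  GoodA : ℤ → Set
  GoodA a = Intv⊆ ℓℤ (+ 2 ℤ.* ℓℤ ℤ.- a) (sumset ℓ Lset)
          × Intv⊆ (+ 2 ℤ.* rℤ ℤ.- + 2 ℤ.* ℓℤ ℤ.+ a ℤ.- + 2) (+ 2 ℤ.* rℤ ℤ.- ℓℤ ℤ.- + 2) (sumset r Rset)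

  IsSmallestA : ℤ → Set
  IsSmallestA a = GoodA a × (∀ (b : ℤ) → GoodA b → a ℤ.≤ b)

  τL : ℤ → ℕ
  τL a = countIn ℓ Lset (λ i → i ≤ᵇ ℓℤ ℤ.- a ℤ.+ + 1)

  τR : ℤ → ℕ
  τR a = countIn r Rset (λ i → rℤ ℤ.- ℓℤ ℤ.+ a ℤ.- + 2 ≤ᵇ i)

  Event : ℤ → Subset (r ℕ.∸ 2 ℕ.* ℓ) → Bool
  Event a M = Intv⊆ᵇ (+ 2 ℤ.* ℓℤ ℤ.- a ℤ.+ + 1) (+ 2 ℤ.* rℤ ℤ.- + 2 ℤ.* ℓℤ ℤ.+ a ℤ.- + 3) (sumset r (Sset M))

  ProbEvent : ℤ → ℚ
  ProbEvent a = Prob (r ℕ.∸ 2 ℕ.* ℓ) (Event a)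

  -- 1 - (a-2)(2^{-τ(R)} + 2^{-τ(L)}) - 6(2^{-|L|} + 2^{-|R|}) - ε   (|R| = |R₀|)
  Bound : ℤ → ℚ → ℚ
  Bound a ε = ℚ.1ℚ ℚ.- toℚ (a ℤ.- + 2) ℚ.* (pow2neg (τR a) ℚ.+ pow2neg (τL a))
                ℚ.- toℚ (+ 6) ℚ.* (pow2neg (Data.Fin.Subset.∣ L ∣) ℚ.+ pow2neg (Data.Fin.Subset.∣ R₀ ∣))
                ℚ.- ε

module Submission where

-- Probabilities are counts over the 2^n subsets of [0,n), n = r - 2ℓ.  We first
-- develop general counting facts: toggling one coordinate shows that an event ignoring
-- position p contains p half of the time, and avoids a pair {p, q} three quarters of the
-- time.  Iterating gives exact probabilities for two kinds of events: AvoidMarked (a set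
-- of κ positions misses M; probability 2^-κ) and NoMirrorPair (no pair i + j = const of a
-- window of length k lies in M; probability 3^⌊k/2⌋ / 2^k), and their product for
-- disjoint positions.  Summing 3^⌊k/2⌋ / 2^k gives at most 6, and the terms decay like
-- (3/4)^(k/2).
-- For the theorem, minimality forces a = A + 2 with A < ℓ.  If the event fails, some
-- target x is missing from S + S; x is either near an end of the interval (then L + M
-- resp. R + M misses x, probability 2^-τ) or in the bulk at distance k from an end (then
-- M + M misses x and, for k ≤ n - ℓ, also L + M resp. R + M does).  The union bound over
-- all targets gives A 2^-τ per side for the ends, 6 · 2^-|L| and 6 · 2^-|R| for the bulk
-- terms with k ≤ n - ℓ, and for the remaining at most 2ℓ terms (3/4)^h each, which is
-- below ε / (2ℓ) once n ≥ ℓ + 2h with h chosen from ε.  Finally the count bounds are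
-- converted into the rational inequality of the statement.

open import Defs
open import Data.Nat using (ℕ; _≤_; _<_; _*_)
open import Data.Integer using (ℤ)
open import Data.Rational using (ℚ; 0ℚ) renaming (_≤_ to _≤ℚ_; _<_ to _<ℚ_)
open import Data.Fin.Subset using (Subset)
open import Data.Product using (∃-syntax)

open import Data.Bool using (Bool; true; false; _∧_; _∨_; not; T; if_then_else_)
open import Data.Bool.Properties using (∧-comm; ∧-identityʳ; ∧-zeroʳ; ∨-zeroʳ)
open import Data.Bool.ListAction using (any; all)
open import Data.Nat as ℕ using (zero; suc; _+_; _^_; _∸_; z≤n; s≤s; NonZero; _<?_; _≤?_)
open import Data.Nat.Properties
open import Data.Nat.Tactic.RingSolver using (solve-∀)
open import Algebra.Properties.CommutativeSemigroup +-commutativeSemigroup using (interchange)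
open import Data.Integer as ℤ using (+_; -[1+_])
import Data.Integer.Properties as ℤP
import Data.Integer.Tactic.RingSolver as ℤ-Solver
import Data.Rational as ℚ
open import Data.Rational using (mkℚ; _/_; ↥_; ↧_; toℚᵘ; 1ℚ)
open import Data.Integer.GCD using (gcd)
import Data.Rational.Properties as ℚP
open import Data.Rational.Unnormalised as ℚᵘ using (*≡*; *≤*) renaming (_/_ to _/ᵘ_; _≃_ to _≃ᵘ_)
import Data.Rational.Unnormalised.Properties as ℚᵘP
open import Data.Rational.Solver using (module +-*-Solver)
import Data.Fin.Subset as FS
open import Data.Vec using ([]; _∷_; lookup)
open import Data.Fin using (fromℕ<)
open import Data.List using (List; []; _∷_; foldr; concatMap; applyUpTo)
open import Data.Product using (∃; _×_; _,_; proj₁; proj₂; map₁; map₂)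
open import Data.Sum using (_⊎_; inj₁; inj₂; [_,_])
open import Data.Empty using (⊥-elim)
open import Relation.Nullary using (¬_; yes; no; does)
open import Relation.Nullary.Decidable using (dec-true; dec-false)
open import Relation.Binary.PropositionalEquality hiding ([_])

-- Counting events over the uniform space of subsets of [0,n).

countList : {A : Set} → (A → Bool) → List A → ℕ
countList E = foldr (λ s c → if E s then suc c else c) 0

bit : Bool → ℕ
bit true = 1
bit false = 0

countList-cons : {A : Set} (E : A → Bool) (x : A) (xs : List A) →
  countList E (x ∷ xs) ≡ bit (E x) + countList E xs
countList-cons E x xs with E x
... | true = refl
... | false = refl

count-suc : (n : ℕ) (E : Subset (suc n) → Bool) →
  countSubsets (suc n) E ≡ countSubsets n (λ s → E (true ∷ s)) + countSubsets n (λ s → E (false ∷ s))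
count-suc n E = sections (allSubsets n)
  where
  sections : (xs : List (Subset n)) →
    countList E (concatMap (λ s → (true ∷ s) ∷ (false ∷ s) ∷ []) xs)
      ≡ countList (λ s → E (true ∷ s)) xs + countList (λ s → E (false ∷ s)) xs
  sections [] = refl
  sections (x ∷ xs) with E (true ∷ x) | E (false ∷ x) | sections xs
  ... | true  | true  | ih = cong suc (trans (cong suc ih) (sym (+-suc _ _)))
  ... | true  | false | ih = cong suc ih
  ... | false | true  | ih = trans (cong suc ih) (sym (+-suc _ _))
  ... | false | false | ih = ih

count-zero : (E : Subset 0 → Bool) → countSubsets 0 E ≡ bit (E [])
count-zero E with E []
... | true = refl
... | false = refl

count-ext : (n : ℕ) (E F : Subset n → Bool) → (∀ s → E s ≡ F s) → countSubsets n E ≡ countSubsets n F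
count-ext zero E F h = trans (count-zero E) (trans (cong bit (h [])) (sym (count-zero F)))
count-ext (suc n) E F h = trans (count-suc n E) (trans
  (cong₂ _+_ (count-ext n _ _ (λ s → h (true ∷ s))) (count-ext n _ _ (λ s → h (false ∷ s))))
  (sym (count-suc n F)))

count-mono : (n : ℕ) (E F : Subset n → Bool) → (∀ s → E s ≡ true → F s ≡ true) →
  countSubsets n E ≤ countSubsets n F
count-mono zero E F h rewrite count-zero E | count-zero F = bit-mono (h [])
  where
  bit-mono : {a b : Bool} → (a ≡ true → b ≡ true) → bit a ≤ bit b
  bit-mono {false} _ = z≤n
  bit-mono {true} h rewrite h refl = ≤-refl
count-mono (suc n) E F h rewrite count-suc n E | count-suc n F =
  +-mono-≤ (count-mono n _ _ (λ s → h (true ∷ s))) (count-mono n _ _ (λ s → h (false ∷ s)))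

count-∨ : (n : ℕ) (E F : Subset n → Bool) →
  countSubsets n (λ s → E s ∨ F s) ≤ countSubsets n E + countSubsets n F
count-∨ zero E F rewrite count-zero E | count-zero F | count-zero (λ s → E s ∨ F s) = bit-∨ (E []) (F [])
  where
  bit-∨ : (a b : Bool) → bit (a ∨ b) ≤ bit a + bit b
  bit-∨ true b = s≤s z≤n
  bit-∨ false b = ≤-refl
count-∨ (suc n) E F rewrite count-suc n E | count-suc n F | count-suc n (λ s → E s ∨ F s) =
  ≤-trans (+-mono-≤ (count-∨ n (λ s → E (true ∷ s)) (λ s → F (true ∷ s)))
                    (count-∨ n (λ s → E (false ∷ s)) (λ s → F (false ∷ s))))
          (≤-reflexive (interchange (countSubsets n (λ s → E (true ∷ s))) (countSubsets n (λ s → F (true ∷ s)))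
                                    (countSubsets n (λ s → E (false ∷ s))) (countSubsets n (λ s → F (false ∷ s)))))

count-split : (n : ℕ) (E F : Subset n → Bool) →
  countSubsets n E ≡ countSubsets n (λ s → E s ∧ F s) + countSubsets n (λ s → E s ∧ not (F s))
count-split zero E F
  rewrite count-zero E | count-zero (λ s → E s ∧ F s) | count-zero (λ s → E s ∧ not (F s)) = bit-split (E []) (F [])
  where
  bit-split : (a b : Bool) → bit a ≡ bit (a ∧ b) + bit (a ∧ not b)
  bit-split true true = refl
  bit-split true false = refl
  bit-split false b = refl
count-split (suc n) E F = trans (count-suc n E) (trans
  (cong₂ _+_ (count-split n (λ s → E (true ∷ s)) (λ s → F (true ∷ s)))
             (count-split n (λ s → E (false ∷ s)) (λ s → F (false ∷ s))))
  (trans (interchange (countSubsets n (λ s → E (true ∷ s) ∧ F (true ∷ s)))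
                      (countSubsets n (λ s → E (true ∷ s) ∧ not (F (true ∷ s))))
                      (countSubsets n (λ s → E (false ∷ s) ∧ F (false ∷ s)))
                      (countSubsets n (λ s → E (false ∷ s) ∧ not (F (false ∷ s)))))
   (sym (cong₂ _+_ (count-suc n (λ s → E s ∧ F s)) (count-suc n (λ s → E s ∧ not (F s)))))))

count-true : (n : ℕ) → countSubsets n (λ _ → true) ≡ 2 ^ n
count-true zero = refl
count-true (suc n) = trans (count-suc n (λ _ → true))
  (trans (cong₂ _+_ (count-true n) (count-true n)) (cong (λ z → 2 ^ n + z) (sym (+-identityʳ (2 ^ n)))))

count-false : (n : ℕ) → countSubsets n (λ _ → false) ≡ 0
count-false zero = refl
count-false (suc n) = trans (count-suc n (λ _ → false)) (cong₂ _+_ (count-false n) (count-false n))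

-- Single coordinates: membership, toggling, and events that ignore a coordinate.

-- Membership of a position in a subset, with positions as naturals (false out of range).
memberAt : {n : ℕ} → Subset n → ℕ → Bool
memberAt [] _ = false
memberAt (b ∷ s) zero = b
memberAt (b ∷ s) (suc i) = memberAt s i

-- Toggling the membership of position p; a bijection of the sample space.
toggle : {n : ℕ} → ℕ → Subset n → Subset n
toggle _ [] = []
toggle zero (b ∷ s) = not b ∷ s
toggle (suc i) (b ∷ s) = b ∷ toggle i s

count-toggle : (n p : ℕ) (E : Subset n → Bool) → countSubsets n E ≡ countSubsets n (λ s → E (toggle p s))
count-toggle zero p E = count-ext zero E (λ s → E (toggle p s)) (λ { [] → refl })
count-toggle (suc n) zero E = trans (count-suc n E)
  (trans (+-comm (countSubsets n (λ s → E (true ∷ s))) (countSubsets n (λ s → E (false ∷ s))))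
         (sym (count-suc n (λ s → E (toggle zero s)))))
count-toggle (suc n) (suc p) E = trans (count-suc n E) (trans
  (cong₂ _+_ (count-toggle n p (λ s → E (true ∷ s))) (count-toggle n p (λ s → E (false ∷ s))))
  (sym (count-suc n (λ s → E (toggle (suc p) s)))))

memberAt-toggle-same : {n : ℕ} (p : ℕ) (s : Subset n) → p < n → memberAt (toggle p s) p ≡ not (memberAt s p)
memberAt-toggle-same zero (b ∷ s) _ = refl
memberAt-toggle-same (suc p) (b ∷ s) (s≤s p<n) = memberAt-toggle-same p s p<n

memberAt-toggle-other : {n : ℕ} (p q : ℕ) (s : Subset n) → p ≢ q → memberAt (toggle p s) q ≡ memberAt s q
memberAt-toggle-other p q [] _ = refl
memberAt-toggle-other zero zero (b ∷ s) p≢q = ⊥-elim (p≢q refl)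
memberAt-toggle-other zero (suc q) (b ∷ s) _ = refl
memberAt-toggle-other (suc p) zero (b ∷ s) _ = refl
memberAt-toggle-other (suc p) (suc q) (b ∷ s) p≢q = memberAt-toggle-other p q s (λ e → p≢q (cong suc e))

Ignores : {n : ℕ} → ℕ → (Subset n → Bool) → Set
Ignores p E = ∀ s → E (toggle p s) ≡ E s

-- An event ignoring p is met equally often with and without p (toggling p swaps the two).
count-balanced : (n p : ℕ) (E : Subset n → Bool) → Ignores p E → p < n →
  countSubsets n (λ s → E s ∧ memberAt s p) ≡ countSubsets n (λ s → E s ∧ not (memberAt s p))
count-balanced n p E ignores p<n = trans (count-toggle n p (λ s → E s ∧ memberAt s p))
  (count-ext n _ _ (λ s → cong₂ _∧_ (ignores s) (memberAt-toggle-same p s p<n)))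

count-avoid-one : (n p : ℕ) (E : Subset n → Bool) → Ignores p E → p < n →
  2 * countSubsets n (λ s → E s ∧ not (memberAt s p)) ≡ countSubsets n E
count-avoid-one n p E ignores p<n = begin
  2 * Z                                               ≡⟨ cong (_+_ Z) (+-identityʳ Z) ⟩
  Z + Z                                               ≡⟨ cong (_+ Z) (sym (count-balanced n p E ignores p<n)) ⟩
  countSubsets n (λ s → E s ∧ memberAt s p) + Z       ≡⟨ sym (count-split n E (λ s → memberAt s p)) ⟩
  countSubsets n E                                    ∎
  where
  open ≡-Reasoning
  Z = countSubsets n (λ s → E s ∧ not (memberAt s p))

count-double : (n p : ℕ) (E : Subset n → Bool) → Ignores p E → p < n →
  countSubsets n E ≡ 2 * countSubsets n (λ s → E s ∧ memberAt s p)
count-double n p E ignores p<n = begin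
  countSubsets n E    ≡⟨ count-split n E (λ s → memberAt s p) ⟩
  Y + _               ≡⟨ cong (_+_ Y) (sym (count-balanced n p E ignores p<n)) ⟩
  Y + Y               ≡⟨ cong (_+_ Y) (sym (+-identityʳ Y)) ⟩
  2 * Y               ∎
  where
  open ≡-Reasoning
  Y = countSubsets n (λ s → E s ∧ memberAt s p)

count-avoid-pair : (n p q : ℕ) (E : Subset n → Bool) → Ignores p E → Ignores q E → p ≢ q → p < n → q < n →
  4 * countSubsets n (λ s → E s ∧ not (memberAt s p ∧ memberAt s q)) ≡ 3 * countSubsets n E
count-avoid-pair n p q E ignores-p ignores-q p≢q p<n q<n =
  three-quarters (countSubsets n E) Y _ (count-split n E (λ s → memberAt s p ∧ memberAt s q)) E≡4Y
  where
  Y = countSubsets n (λ s → E s ∧ (memberAt s p ∧ memberAt s q))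
  Eq : Subset n → Bool
  Eq s = E s ∧ memberAt s q
  Eq-ignores-p : Ignores p Eq
  Eq-ignores-p s = cong₂ _∧_ (ignores-p s) (memberAt-toggle-other p q s p≢q)
  reassoc : ∀ a b c → (a ∧ b) ∧ c ≡ a ∧ (c ∧ b)
  reassoc true b c = ∧-comm b c
  reassoc false b c = refl
  E≡4Y : countSubsets n E ≡ 4 * Y
  E≡4Y = begin
    countSubsets n E                                        ≡⟨ count-double n q E ignores-q q<n ⟩
    2 * countSubsets n Eq                                   ≡⟨ cong (2 *_) (count-double n p Eq Eq-ignores-p p<n) ⟩
    2 * (2 * countSubsets n (λ s → Eq s ∧ memberAt s p))    ≡⟨ cong (λ z → 2 * (2 * z)) (count-ext n _ _ (λ s → reassoc (E s) (memberAt s q) (memberAt s p))) ⟩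
    2 * (2 * Y)                                             ≡⟨ *-assoc 2 2 Y ⟨
    4 * Y                                                   ∎
    where open ≡-Reasoning
  three-quarters : ∀ e y z → e ≡ y + z → e ≡ 4 * y → 4 * z ≡ 3 * e
  three-quarters e y z e≡y+z e≡4y = trans (cong (4 *_) z≡3y) (trans (reorder y) (cong (3 *_) (sym e≡4y)))
    where
    z≡3y : z ≡ 3 * y
    z≡3y = +-cancelˡ-≡ y z (3 * y) (trans (sym e≡y+z) e≡4y)
    reorder : ∀ y → 4 * (3 * y) ≡ 3 * (4 * y)
    reorder = solve-∀

-- For a marking P of indices u < d and
-- injective positions pos, AvoidMarked P pos d M says pos u ∉ M for every marked u;
-- it has probability 2^-(number of marked indices).

AvoidMarked : {n : ℕ} (P : ℕ → Bool) (pos : ℕ → ℕ) (d : ℕ) → Subset n → Bool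
AvoidMarked P pos zero s = true
AvoidMarked P pos (suc d) s = not (P d ∧ memberAt s (pos d)) ∧ AvoidMarked P pos d s

marked : (P : ℕ → Bool) → ℕ → ℕ
marked P zero = 0
marked P (suc d) = marked P d + bit (P d)

AvoidMarked-ignores : {n : ℕ} (P : ℕ → Bool) (pos : ℕ → ℕ) (d p : ℕ) →
  (∀ u → u < d → pos u ≢ p) → Ignores {n} p (AvoidMarked P pos d)
AvoidMarked-ignores P pos zero p fresh s = refl
AvoidMarked-ignores P pos (suc d) p fresh s = cong₂ _∧_
  (cong (λ b → not (P d ∧ b)) (memberAt-toggle-other p (pos d) s (λ e → fresh d ≤-refl (sym e))))
  (AvoidMarked-ignores P pos d p (λ u u<d → fresh u (m≤n⇒m≤1+n u<d)) s)

count-AvoidMarked : (n : ℕ) (P : ℕ → Bool) (pos : ℕ → ℕ) (d : ℕ) (E : Subset n → Bool) →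
  (∀ u → u < d → pos u < n) → (∀ u v → u < d → v < u → pos v ≢ pos u) →
  (∀ u → u < d → Ignores (pos u) E) →
  2 ^ marked P d * countSubsets n (λ s → E s ∧ AvoidMarked P pos d s) ≡ countSubsets n E
count-AvoidMarked n P pos zero E _ _ _ = trans (+-identityʳ _) (count-ext n _ _ (λ s → ∧-identityʳ (E s)))
count-AvoidMarked n P pos (suc d) E in-range injective ignores with P d
... | true = begin
  2 ^ (marked P d + 1) * countSubsets n (λ s → E s ∧ (not (memberAt s (pos d)) ∧ Avoid s))
      ≡⟨ cong₂ _*_ (^-distribˡ-+-* 2 (marked P d) 1) (count-ext n _ _ (λ s → reassoc (E s) (memberAt s (pos d)) (Avoid s))) ⟩
  2 ^ marked P d * 2 * countSubsets n (λ s → F s ∧ not (memberAt s (pos d)))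
      ≡⟨ *-assoc (2 ^ marked P d) 2 _ ⟩
  2 ^ marked P d * (2 * countSubsets n (λ s → F s ∧ not (memberAt s (pos d))))
      ≡⟨ cong (_*_ (2 ^ marked P d)) (count-avoid-one n (pos d) F F-ignores (in-range d ≤-refl)) ⟩
  2 ^ marked P d * countSubsets n F
      ≡⟨ ih ⟩
  countSubsets n E ∎
  where
  open ≡-Reasoning
  Avoid = AvoidMarked P pos d
  F : Subset n → Bool
  F s = E s ∧ Avoid s
  F-ignores : Ignores (pos d) F
  F-ignores s = cong₂ _∧_ (ignores d ≤-refl s)
    (AvoidMarked-ignores P pos d (pos d) (λ u u<d → injective d u ≤-refl u<d) s)
  reassoc : ∀ a b c → a ∧ (not b ∧ c) ≡ (a ∧ c) ∧ not b
  reassoc true b c = ∧-comm (not b) c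
  reassoc false b c = refl
  ih : 2 ^ marked P d * countSubsets n F ≡ countSubsets n E
  ih = count-AvoidMarked n P pos d E (λ u u<d → in-range u (m≤n⇒m≤1+n u<d))
         (λ u v u<d v<u → injective u v (m≤n⇒m≤1+n u<d) v<u) (λ u u<d → ignores u (m≤n⇒m≤1+n u<d))
... | false = trans (cong (λ k → 2 ^ k * countSubsets n (λ s → E s ∧ AvoidMarked P pos d s)) (+-identityʳ (marked P d)))
  (count-AvoidMarked n P pos d E (λ u u<d → in-range u (m≤n⇒m≤1+n u<d))
     (λ u v u<d v<u → injective u v (m≤n⇒m≤1+n u<d) v<u) (λ u u<d → ignores u (m≤n⇒m≤1+n u<d)))

AvoidMarked-witness : {n : ℕ} (P : ℕ → Bool) (pos : ℕ → ℕ) (d : ℕ) (s : Subset n) →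
  AvoidMarked P pos d s ≡ false → ∃ λ u → u < d × P u ≡ true × memberAt s (pos u) ≡ true
AvoidMarked-witness P pos zero s ()
AvoidMarked-witness P pos (suc d) s fails with P d in Pd | memberAt s (pos d) in hit
... | true | true = d , ≤-refl , Pd , hit
... | true | false = map₂ (map₁ m≤n⇒m≤1+n) (AvoidMarked-witness P pos d s fails)
AvoidMarked-witness P pos (suc d) s fails | false | _ = map₂ (map₁ m≤n⇒m≤1+n) (AvoidMarked-witness P pos d s fails)

-- For the window of indices lo, …, lo+d-1,
-- NoMirrorPair pos lo d M says that for no i + j = 2lo + d - 1 in the window both
-- pos i, pos j ∈ M.  The ⌊d/2⌋ pairs are disjoint, each avoided with probability 3/4,
-- and for odd d the middle singleton is avoided with probability 1/2.

NoMirrorPair : {n : ℕ} (pos : ℕ → ℕ) (lo d : ℕ) → Subset n → Bool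
NoMirrorPair pos lo zero s = true
NoMirrorPair pos lo (suc zero) s = not (memberAt s (pos lo))
NoMirrorPair pos lo (suc (suc d)) s =
  not (memberAt s (pos lo) ∧ memberAt s (pos (lo + suc d))) ∧ NoMirrorPair pos (suc lo) d s

-- 3^⌊d/2⌋, the numerator of P(NoMirrorPair) = 3^⌊d/2⌋ / 2^d.
mirrorWeight : ℕ → ℕ
mirrorWeight zero = 1
mirrorWeight (suc zero) = 1
mirrorWeight (suc (suc d)) = 3 * mirrorWeight d

InWindow : ℕ → ℕ → ℕ → Set
InWindow lo d i = lo ≤ i × i < lo + d

InWindow-shrink : ∀ lo d i → InWindow (suc lo) d i → InWindow lo (suc (suc d)) i
InWindow-shrink lo d i (lo<i , i<end) =
  ≤-trans (n≤1+n lo) lo<i , ≤-trans i<end (≤-trans (≤-reflexive (sym (+-suc lo d))) (+-monoʳ-≤ lo (n≤1+n (suc d))))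

InWindow-first : ∀ lo d → InWindow lo (suc d) lo
InWindow-first lo d = ≤-refl , m<m+n lo (s≤s z≤n)

InWindow-last : ∀ lo d → InWindow lo (suc d) (lo + d)
InWindow-last lo d = m≤m+n lo d , +-monoʳ-< lo (n<1+n d)

NoMirrorPair-ignores : {n : ℕ} (pos : ℕ → ℕ) (lo d p : ℕ) →
  (∀ i → InWindow lo d i → pos i ≢ p) → Ignores {n} p (NoMirrorPair pos lo d)
NoMirrorPair-ignores pos lo zero p fresh s = refl
NoMirrorPair-ignores pos lo (suc zero) p fresh s =
  cong not (memberAt-toggle-other p (pos lo) s (λ e → fresh lo (InWindow-first lo 0) (sym e)))
NoMirrorPair-ignores pos lo (suc (suc d)) p fresh s = cong₂ _∧_
  (cong₂ (λ a b → not (a ∧ b))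
    (memberAt-toggle-other p (pos lo) s (λ e → fresh lo (InWindow-first lo (suc d)) (sym e)))
    (memberAt-toggle-other p (pos (lo + suc d)) s (λ e → fresh (lo + suc d) (InWindow-last lo (suc d)) (sym e))))
  (NoMirrorPair-ignores pos (suc lo) d p (λ i w → fresh i (InWindow-shrink lo d i w)) s)

count-NoMirrorPair : (n : ℕ) (pos : ℕ → ℕ) (lo d : ℕ) (E : Subset n → Bool) →
  (∀ i → InWindow lo d i → pos i < n) →
  (∀ i j → InWindow lo d i → InWindow lo d j → i ≢ j → pos i ≢ pos j) →
  (∀ i → InWindow lo d i → Ignores (pos i) E) →
  2 ^ d * countSubsets n (λ s → E s ∧ NoMirrorPair pos lo d s) ≡ mirrorWeight d * countSubsets n E
count-NoMirrorPair n pos lo zero E _ _ _ = cong (_+ 0) (count-ext n _ _ (λ s → ∧-identityʳ (E s)))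
count-NoMirrorPair n pos lo (suc zero) E in-range _ ignores =
  trans (count-avoid-one n (pos lo) E (ignores lo first) (in-range lo first)) (sym (+-identityʳ _))
  where first = InWindow-first lo 0
count-NoMirrorPair n pos lo (suc (suc d)) E in-range injective ignores = begin
  2 ^ (2 + d) * countSubsets n (λ s → E s ∧ (avoidPair s ∧ Rest s))
    ≡⟨ cong₂ _*_ (sym (*-assoc 2 2 (2 ^ d))) (count-ext n _ _ (λ s → reassoc (E s) (avoidPair s) (Rest s))) ⟩
  4 * 2 ^ d * countSubsets n (λ s → F s ∧ avoidPair s)
    ≡⟨ *-assoc 4 (2 ^ d) _ ⟩
  4 * (2 ^ d * countSubsets n (λ s → F s ∧ avoidPair s))
    ≡⟨ swap-front 4 (2 ^ d) _ ⟩
  2 ^ d * (4 * countSubsets n (λ s → F s ∧ avoidPair s))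
    ≡⟨ cong (_*_ (2 ^ d)) (count-avoid-pair n (pos lo) (pos hi) F (F-ignores lo first lo∉)
                                           (F-ignores hi last hi∉) lo≢hi (in-range lo first) (in-range hi last)) ⟩
  2 ^ d * (3 * countSubsets n F)
    ≡⟨ swap-front (2 ^ d) 3 _ ⟩
  3 * (2 ^ d * countSubsets n F)
    ≡⟨ cong (3 *_) ih ⟩
  3 * (mirrorWeight d * countSubsets n E)
    ≡⟨ *-assoc 3 (mirrorWeight d) _ ⟨
  mirrorWeight (2 + d) * countSubsets n E ∎
  where
  open ≡-Reasoning
  hi = lo + suc d
  first = InWindow-first lo (suc d)
  last = InWindow-last lo (suc d)
  avoidPair : Subset n → Bool
  avoidPair s = not (memberAt s (pos lo) ∧ memberAt s (pos hi))
  Rest = NoMirrorPair pos (suc lo) d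
  F : Subset n → Bool
  F s = E s ∧ Rest s
  inner : ∀ i → InWindow (suc lo) d i → InWindow lo (suc (suc d)) i
  inner = InWindow-shrink lo d
  F-ignores : ∀ i → InWindow lo (suc (suc d)) i → ¬ InWindow (suc lo) d i → Ignores (pos i) F
  F-ignores i w i∉ s = cong₂ _∧_ (ignores i w s) (NoMirrorPair-ignores pos (suc lo) d (pos i)
    (λ j wj e → injective j i (inner j wj) w (λ j≡i → i∉ (subst (InWindow (suc lo) d) j≡i wj)) e) s)
  lo∉ : ¬ InWindow (suc lo) d lo
  lo∉ (lo<lo , _) = 1+n≰n lo<lo
  hi∉ : ¬ InWindow (suc lo) d hi
  hi∉ (_ , hi<end) = 1+n≰n (≤-trans hi<end (≤-reflexive (sym (+-suc lo d))))
  lo≢hi : pos lo ≢ pos hi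
  lo≢hi = injective lo hi first last (λ e → <-irrefl e (m<m+n lo (s≤s z≤n)))
  reassoc : ∀ a b c → a ∧ (b ∧ c) ≡ (a ∧ c) ∧ b
  reassoc true b c = ∧-comm b c
  reassoc false b c = refl
  swap-front : ∀ a b c → a * (b * c) ≡ b * (a * c)
  swap-front = solve-∀
  ih : 2 ^ d * countSubsets n F ≡ mirrorWeight d * countSubsets n E
  ih = count-NoMirrorPair n pos (suc lo) d E (λ i w → in-range i (inner i w))
         (λ i j wi wj → injective i j (inner i wi) (inner j wj)) (λ i w → ignores i (inner i w))

MirrorHit : {n : ℕ} (pos : ℕ → ℕ) (lo d : ℕ) → Subset n → Set
MirrorHit pos lo d s = ∃ λ i → ∃ λ j → InWindow lo d i × InWindow lo d j × i + j + 1 ≡ lo + lo + d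
  × memberAt s (pos i) ≡ true × memberAt s (pos j) ≡ true

MirrorHit-widen : {n : ℕ} (pos : ℕ → ℕ) (lo d : ℕ) (s : Subset n) →
  MirrorHit pos (suc lo) d s → MirrorHit pos lo (suc (suc d)) s
MirrorHit-widen pos lo d s (i , j , wi , wj , sums , hi , hj) =
  i , j , InWindow-shrink lo d i wi , InWindow-shrink lo d j wj , trans sums (shift lo d) , hi , hj
  where
  shift : ∀ lo d → suc lo + suc lo + d ≡ lo + lo + suc (suc d)
  shift = solve-∀

NoMirrorPair-witness : {n : ℕ} (pos : ℕ → ℕ) (lo d : ℕ) (s : Subset n) →
  NoMirrorPair pos lo d s ≡ false → MirrorHit pos lo d s
NoMirrorPair-witness pos lo zero s ()
NoMirrorPair-witness pos lo (suc zero) s fails with memberAt s (pos lo) in hit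
... | true = lo , lo , InWindow-first lo 0 , InWindow-first lo 0 , refl , hit , hit
NoMirrorPair-witness pos lo (suc (suc d)) s fails
  with memberAt s (pos lo) in hit₁ | memberAt s (pos (lo + suc d)) in hit₂
... | true | true = lo , lo + suc d , InWindow-first lo (suc d) , InWindow-last lo (suc d) , sums lo d , hit₁ , hit₂
  where
  sums : ∀ lo d → lo + (lo + suc d) + 1 ≡ lo + lo + suc (suc d)
  sums = solve-∀
... | true | false = MirrorHit-widen pos lo d s (NoMirrorPair-witness pos (suc lo) d s fails)
... | false | _ = MirrorHit-widen pos lo d s (NoMirrorPair-witness pos (suc lo) d s fails)

-- Finite sums and the geometric estimates for mirrorWeight.

sumBelow : (ℕ → ℕ) → ℕ → ℕ
sumBelow f zero = 0
sumBelow f (suc K) = sumBelow f K + f K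

sumBelow-split : (f : ℕ → ℕ) (a b : ℕ) → sumBelow f (a + b) ≡ sumBelow f a + sumBelow (λ t → f (a + t)) b
sumBelow-split f a zero = trans (cong (sumBelow f) (+-identityʳ a)) (sym (+-identityʳ _))
sumBelow-split f a (suc b) rewrite +-suc a b =
  trans (cong (_+ f (a + b)) (sumBelow-split f a b)) (+-assoc (sumBelow f a) _ _)

sumBelow-bound : (f : ℕ → ℕ) (K Q N : ℕ) → (∀ t → t < K → f t * Q ≤ N) → sumBelow f K * Q ≤ K * N
sumBelow-bound f zero Q N _ = z≤n
sumBelow-bound f (suc K) Q N bound = begin
  (sumBelow f K + f K) * Q        ≡⟨ *-distribʳ-+ Q (sumBelow f K) (f K) ⟩
  sumBelow f K * Q + f K * Q      ≤⟨ +-mono-≤ (sumBelow-bound f K Q N (λ t t<K → bound t (m≤n⇒m≤1+n t<K))) (bound K ≤-refl) ⟩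
  K * N + N                       ≡⟨ +-comm (K * N) N ⟩
  suc K * N                       ∎
  where open ≤-Reasoning

-- Slack of the geometric-sum invariant below; it depends on the parity of K.
geoSlack : ℕ → ℕ
geoSlack zero = 6
geoSlack (suc zero) = 10
geoSlack (suc (suc K)) = geoSlack K

mirrorWeight-step : ∀ K →
    (mirrorWeight (suc K) ≡ mirrorWeight K × geoSlack K ≡ 6 × geoSlack (suc K) ≡ 10)
  ⊎ (mirrorWeight (suc K) ≡ 3 * mirrorWeight K × geoSlack K ≡ 10 × geoSlack (suc K) ≡ 6)
mirrorWeight-step zero = inj₁ (refl , refl , refl)
mirrorWeight-step (suc zero) = inj₂ (refl , refl , refl)
mirrorWeight-step (suc (suc K)) with mirrorWeight-step K
... | inj₁ (w , a , b) = inj₁ (cong (3 *_) w , a , b)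
... | inj₂ (w , a , b) = inj₂ (cong (3 *_) w , a , b)

geometric-invariant : (f : ℕ → ℕ) (W N K : ℕ) → (∀ k → k < K → 2 ^ k * (W * f k) ≤ mirrorWeight k * N) →
  2 ^ K * (W * sumBelow f K) + geoSlack K * (mirrorWeight K * N) ≤ 6 * N * 2 ^ K
geometric-invariant f W N zero _ = ≤-reflexive (base W N)
  where
  base : ∀ W N → 1 * (W * 0) + 6 * (1 * N) ≡ 6 * N * 1
  base = solve-∀
geometric-invariant f W N (suc K) bound
  with mirrorWeight-step K | geometric-invariant f W N K (λ k k<K → bound k (m≤n⇒m≤1+n k<K))
... | inj₁ (w , a , b) | ih rewrite w | a | b =
  ≤-trans (≤-reflexive (expand (2 ^ K) W (sumBelow f K) (f K) (mirrorWeight K) N))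
  (≤-trans (+-monoˡ-≤ _ (*-monoʳ-≤ 2 (bound K ≤-refl)))
  (≤-trans (≤-reflexive (collect (2 ^ K) W (sumBelow f K) (mirrorWeight K) N))
  (≤-trans (*-monoʳ-≤ 2 ih) (≤-reflexive (double N (2 ^ K))))))
  where
  expand : ∀ p W S x w N → 2 * p * (W * (S + x)) + 10 * (w * N) ≡ 2 * (p * (W * x)) + (2 * (p * (W * S)) + 10 * (w * N))
  expand = solve-∀
  collect : ∀ p W S w N → 2 * (w * N) + (2 * (p * (W * S)) + 10 * (w * N)) ≡ 2 * (p * (W * S) + 6 * (w * N))
  collect = solve-∀
  double : ∀ N p → 2 * (6 * N * p) ≡ 6 * N * (2 * p)
  double = solve-∀
... | inj₂ (w , a , b) | ih rewrite w | a | b =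
  ≤-trans (≤-reflexive (expand (2 ^ K) W (sumBelow f K) (f K) (mirrorWeight K) N))
  (≤-trans (+-monoˡ-≤ _ (*-monoʳ-≤ 2 (bound K ≤-refl)))
  (≤-trans (≤-reflexive (collect (2 ^ K) W (sumBelow f K) (mirrorWeight K) N))
  (≤-trans (*-monoʳ-≤ 2 ih) (≤-reflexive (double N (2 ^ K))))))
  where
  expand : ∀ p W S x w N → 2 * p * (W * (S + x)) + 6 * (3 * w * N) ≡ 2 * (p * (W * x)) + (2 * (p * (W * S)) + 18 * (w * N))
  expand = solve-∀
  collect : ∀ p W S w N → 2 * (w * N) + (2 * (p * (W * S)) + 18 * (w * N)) ≡ 2 * (p * (W * S) + 10 * (w * N))
  collect = solve-∀
  double : ∀ N p → 2 * (6 * N * p) ≡ 6 * N * (2 * p)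
  double = solve-∀

-- Σ_k mirrorWeight k / 2^k ≤ 6: if 2^k W f k ≤ mirrorWeight k · N for all k < K, then W Σ f ≤ 6 N.
geometric-bound : (f : ℕ → ℕ) (W N K : ℕ) → (∀ k → k < K → 2 ^ k * (W * f k) ≤ mirrorWeight k * N) →
  W * sumBelow f K ≤ 6 * N
geometric-bound f W N K bound = *-cancelˡ-≤ (2 ^ K) {{m^n≢0 2 K}}
  (≤-trans (m≤m+n _ _) (≤-trans (geometric-invariant f W N K bound) (≤-reflexive (*-comm (6 * N) (2 ^ K)))))

mirrorWeight≤2^ : ∀ k → mirrorWeight k ≤ 2 ^ k
mirrorWeight≤2^ zero = ≤-refl
mirrorWeight≤2^ (suc zero) = s≤s z≤n
mirrorWeight≤2^ (suc (suc k)) =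
  ≤-trans (*-monoʳ-≤ 3 (mirrorWeight≤2^ k)) (≤-trans (*-monoˡ-≤ (2 ^ k) {3} {4} (s≤s (s≤s (s≤s z≤n)))) (≤-reflexive (*-assoc 2 2 (2 ^ k))))

mirrorWeight-decay : ∀ h k → h + h ≤ k → mirrorWeight k * 4 ^ h ≤ 2 ^ k * 3 ^ h
mirrorWeight-decay zero k _ =
  ≤-trans (≤-reflexive (*-identityʳ _)) (≤-trans (mirrorWeight≤2^ k) (≤-reflexive (sym (*-identityʳ _))))
mirrorWeight-decay (suc h) (suc (suc k)) (s≤s hh≤k) =
  ≤-trans (≤-reflexive (regroup (mirrorWeight k) (4 ^ h)))
  (≤-trans (*-monoʳ-≤ 12 (mirrorWeight-decay h k (≤-pred (subst (_≤ suc k) (+-suc h h) hh≤k))))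
  (≤-reflexive (regroup′ (2 ^ k) (3 ^ h))))
  where
  regroup : ∀ w q → 3 * w * (4 * q) ≡ 12 * (w * q)
  regroup = solve-∀
  regroup′ : ∀ p q → 12 * (p * q) ≡ 2 * (2 * p) * (3 * q)
  regroup′ = solve-∀
mirrorWeight-decay (suc h) (suc zero) (s≤s hh≤0) with subst (_≤ zero) (+-suc h h) hh≤0
... | ()

bernoulli : ∀ h → 3 ^ h * (3 + h) ≤ 3 * 4 ^ h
bernoulli zero = ≤-refl
bernoulli (suc h) =
  ≤-trans (≤-reflexive (expand (3 ^ h) h))
  (≤-trans (+-mono-≤ (*-monoʳ-≤ 3 (bernoulli h)) (*-monoʳ-≤ 3 (^-monoˡ-≤ h (s≤s (s≤s (s≤s z≤n))))))
  (≤-reflexive (collect (4 ^ h))))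
  where
  expand : ∀ p h → 3 * p * (3 + suc h) ≡ 3 * (p * (3 + h)) + 3 * p
  expand = solve-∀
  collect : ∀ q → 3 * (3 * q) + 3 * q ≡ 3 * (4 * q)
  collect = solve-∀

-- (3/4)^(3Q) ≤ 1/Q: the exponent h = 3Q makes the decay beat any factor Q.
power-decay : ∀ Q → 3 ^ (3 * Q) * Q ≤ 4 ^ (3 * Q)
power-decay Q = *-cancelˡ-≤ 3
  (≤-trans (≤-reflexive (regroup (3 ^ (3 * Q)) Q))
  (≤-trans (*-monoʳ-≤ (3 ^ (3 * Q)) (m≤n+m (3 * Q) 3)) (bernoulli (3 * Q))))
  where
  regroup : ∀ p Q → 3 * (p * Q) ≡ p * (3 * Q)
  regroup = solve-∀

tail-term-bound : ∀ x k h Q N → 2 ^ k * x ≤ mirrorWeight k * N → h + h ≤ k → 3 ^ h * Q ≤ 4 ^ h → x * Q ≤ N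
tail-term-bound x k h Q N hx hk hQ = *-cancelˡ-≤ (3 ^ h) {{m^n≢0 3 h}}
  (≤-trans (≤-reflexive (swap-front (3 ^ h) x Q)) (≤-trans (*-monoʳ-≤ x hQ) x4^h≤3^hN))
  where
  open ≤-Reasoning
  swap-front : ∀ a b c → a * (b * c) ≡ b * (a * c)
  swap-front = solve-∀
  x4^h≤3^hN : x * 4 ^ h ≤ 3 ^ h * N
  x4^h≤3^hN = *-cancelˡ-≤ (2 ^ k) {{m^n≢0 2 k}} (begin
    2 ^ k * (x * 4 ^ h)               ≡⟨ *-assoc (2 ^ k) x (4 ^ h) ⟨
    2 ^ k * x * 4 ^ h                 ≤⟨ *-monoˡ-≤ (4 ^ h) hx ⟩
    mirrorWeight k * N * 4 ^ h        ≡⟨ swap-back (mirrorWeight k) N (4 ^ h) ⟩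
    mirrorWeight k * 4 ^ h * N        ≤⟨ *-monoˡ-≤ N (mirrorWeight-decay h k hk) ⟩
    2 ^ k * 3 ^ h * N                 ≡⟨ *-assoc (2 ^ k) (3 ^ h) N ⟩
    2 ^ k * (3 ^ h * N)               ∎)
    where
    swap-back : ∀ w N q → w * N * q ≡ w * q * N
    swap-back = solve-∀

-- Rational arithmetic with fractions of naturals.

toℚᵘ-/ : ∀ (i : ℤ) (d : ℕ) .{{_ : NonZero d}} → toℚᵘ (i / d) ≃ᵘ (i /ᵘ d)
toℚᵘ-/ i (suc d) = *≡* (subst₂ (λ x y → x ℤ.* + suc d ≡ i ℤ.* y) (sym (ℚP.↥ᵘ-toℚᵘ q)) (sym (ℚP.↧ᵘ-toℚᵘ q))
  (trans (cong (↥ q ℤ.*_) (sym (ℚP.↧-/ i (suc d))))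
  (trans (regroup (↥ q) (↧ q) (gcd i (+ suc d))) (cong (ℤ._* ↧ q) (ℚP.↥-/ i (suc d))))))
  where
  q = i / suc d
  regroup : ∀ a b g → a ℤ.* (b ℤ.* g) ≡ a ℤ.* g ℤ.* b
  regroup = ℤ-Solver.solve-∀

/-≤-cross : ∀ (i j d e : ℕ) .{{_ : NonZero d}} .{{_ : NonZero e}} → i * e ≤ j * d → (+ i) / d ℚ.≤ (+ j) / e
/-≤-cross i j (suc d) (suc e) ie≤jd = ℚP.toℚᵘ-cancel-≤
  (ℚᵘP.≤-respˡ-≃ (ℚᵘP.≃-sym (toℚᵘ-/ (+ i) (suc d))) (ℚᵘP.≤-respʳ-≃ (ℚᵘP.≃-sym (toℚᵘ-/ (+ j) (suc e)))
    (*≤* (subst₂ ℤ._≤_ (ℤP.pos-* i (suc e)) (ℤP.pos-* j (suc d)) (ℤ.+≤+ ie≤jd)))))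

toℚ*pow2neg : ∀ (a k : ℕ) → toℚ (+ a) ℚ.* pow2neg k ≡ _/_ (+ a) (2 ^ k) {{m^n≢0 2 k}}
toℚ*pow2neg a k = ℚP.toℚᵘ-injective (ℚᵘP.≃-trans (ℚP.toℚᵘ-homo-* (toℚ (+ a)) (pow2neg k))
  (ℚᵘP.≃-trans (ℚᵘP.*-cong (toℚᵘ-/ (+ a) 1) (toℚᵘ-/ (+ 1) (2 ^ k) {{m^n≢0 2 k}}))
               (ℚᵘP.≃-sym (split (2 ^ k) {{m^n≢0 2 k}}))))
  where
  split : ∀ d .{{_ : NonZero d}} → toℚᵘ ((+ a) / d) ≃ᵘ ((+ a) /ᵘ 1) ℚᵘ.* ((+ 1) /ᵘ d)
  split (suc d) = ℚᵘP.≃-trans (toℚᵘ-/ (+ a) (suc d))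
    (*≡* (cong₂ ℤ._*_ (sym (ℤP.*-identityʳ (+ a))) (cong +_ (cong suc (+-identityʳ d)))))

/-+-same : ∀ (a b d : ℕ) .{{_ : NonZero d}} → (+ a) / d ℚ.+ (+ b) / d ≡ (+ (a + b)) / d
/-+-same a b (suc d) = ℚP.toℚᵘ-injective (ℚᵘP.≃-trans (ℚP.toℚᵘ-homo-+ ((+ a) / suc d) ((+ b) / suc d))
  (ℚᵘP.≃-trans (ℚᵘP.+-cong (toℚᵘ-/ (+ a) (suc d)) (toℚᵘ-/ (+ b) (suc d)))
  (ℚᵘP.≃-trans (*≡* cross) (ℚᵘP.≃-sym (toℚᵘ-/ (+ (a + b)) (suc d))))))
  where
  cross : (+ a ℤ.* + suc d ℤ.+ + b ℤ.* + suc d) ℤ.* + suc d ≡ + (a + b) ℤ.* + (suc d * suc d)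
  cross = trans (regroup (+ a) (+ b) (+ suc d)) (cong₂ ℤ._*_ (sym (ℤP.pos-+ a b)) (sym (ℤP.pos-* (suc d) (suc d))))
    where
    regroup : ∀ a b D → (a ℤ.* D ℤ.+ b ℤ.* D) ℤ.* D ≡ (a ℤ.+ b) ℤ.* (D ℤ.* D)
    regroup = ℤ-Solver.solve-∀

d/d≡1 : ∀ (d : ℕ) .{{_ : NonZero d}} → (+ d) / d ≡ 1ℚ
d/d≡1 (suc d) = ℚP.toℚᵘ-injective (ℚᵘP.≃-trans (toℚᵘ-/ (+ suc d) (suc d)) (*≡* (ℤP.*-comm (+ suc d) (+ 1))))

unit-fraction-below : (ε : ℚ) → 0ℚ <ℚ ε → ∃ λ D → (+ 1) / suc D ≤ℚ ε
unit-fraction-below (mkℚ (+ zero) D _) (ℚ.*<* (ℤ.+<+ ()))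
unit-fraction-below (mkℚ -[1+ k ] D _) (ℚ.*<* ())
unit-fraction-below (mkℚ (+ suc k) D _) _ = D , ℚP.toℚᵘ-cancel-≤ (ℚᵘP.≤-respˡ-≃ (ℚᵘP.≃-sym (toℚᵘ-/ (+ 1) (suc D)))
  (*≤* (subst₂ ℤ._≤_ (ℤP.pos-* 1 (suc D)) (ℤP.pos-* (suc k) (suc D)) (ℤ.+≤+ (*-monoˡ-≤ (suc D) {1} {suc k} (s≤s z≤n))))))

module ProbabilityBound (n : ℕ) where
  N : ℕ
  N = 2 ^ n

  instance
    N≢0 : NonZero N
    N≢0 = m^n≢0 2 n

  fraction : ℕ → ℚ
  fraction x = (+ x) / N

  fraction-+ : ∀ a b → fraction (a + b) ≡ fraction a ℚ.+ fraction b
  fraction-+ a b = sym (/-+-same a b N)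

  fraction-≤-term : ∀ S c τ → S * 2 ^ τ ≤ c * N → fraction S ≤ℚ toℚ (+ c) ℚ.* pow2neg τ
  fraction-≤-term S c τ bound = subst (fraction S ≤ℚ_) (sym (toℚ*pow2neg c τ))
    (/-≤-cross S c N (2 ^ τ) {{N≢0}} {{m^n≢0 2 τ}} bound)

  fraction-five : ∀ a b c d e → fraction (a + b + c + d + e)
    ≡ fraction a ℚ.+ fraction b ℚ.+ fraction c ℚ.+ fraction d ℚ.+ fraction e
  fraction-five a b c d e =
    trans (fraction-+ (a + b + c + d) e) (cong (ℚ._+ fraction e)
    (trans (fraction-+ (a + b + c) d) (cong (ℚ._+ fraction d)
    (trans (fraction-+ (a + b) c) (cong (ℚ._+ fraction c) (fraction-+ a b))))))

  probability-bound : ∀ (good X S₁ S₂ S₃ S₄ Sₘ A τL τR κL κR D : ℕ) (ε : ℚ) →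
    good + X ≡ N → X ≤ S₁ + S₂ + S₃ + S₄ + Sₘ →
    S₁ * 2 ^ τL ≤ A * N → S₂ * 2 ^ κL ≤ 6 * N → S₃ * 2 ^ κR ≤ 6 * N → S₄ * 2 ^ τR ≤ A * N →
    Sₘ * suc D ≤ 1 * N → (+ 1) / suc D ≤ℚ ε →
    1ℚ ℚ.- toℚ (+ A) ℚ.* (pow2neg τR ℚ.+ pow2neg τL) ℚ.- toℚ (+ 6) ℚ.* (pow2neg κL ℚ.+ pow2neg κR) ℚ.- ε
      ≤ℚ fraction good
  probability-bound good X S₁ S₂ S₃ S₄ Sₘ A τL τR κL κR D ε total cover b₁ b₂ b₃ b₄ bₘ D≤ε =
    subst₂ _≤ℚ_ (sym bound≡) (sym good≡) (ℚP.+-monoʳ-≤ 1ℚ (ℚP.neg-antimono-≤ failure≤bound))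
    where
    open +-*-Solver
    failureBound : ℚ
    failureBound = toℚ (+ A) ℚ.* pow2neg τL ℚ.+ toℚ (+ 6) ℚ.* pow2neg κL ℚ.+ toℚ (+ 6) ℚ.* pow2neg κR
        ℚ.+ toℚ (+ A) ℚ.* pow2neg τR ℚ.+ ε
    bound≡ : 1ℚ ℚ.- toℚ (+ A) ℚ.* (pow2neg τR ℚ.+ pow2neg τL) ℚ.- toℚ (+ 6) ℚ.* (pow2neg κL ℚ.+ pow2neg κR) ℚ.- ε
             ≡ 1ℚ ℚ.- failureBound
    bound≡ = solve 8 (λ o a b c s d e f → o :- a :* (b :+ c) :- s :* (d :+ e) :- f
                                        := o :- (a :* c :+ s :* d :+ s :* e :+ a :* b :+ f))
               refl 1ℚ (toℚ (+ A)) (pow2neg τR) (pow2neg τL) (toℚ (+ 6)) (pow2neg κL) (pow2neg κR) ε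
    good≡ : fraction good ≡ 1ℚ ℚ.- fraction X
    good≡ = trans (solve 2 (λ a b → a := a :+ b :- b) refl (fraction good) (fraction X))
      (cong (ℚ._- fraction X) (trans (sym (fraction-+ good X)) (trans (cong fraction total) (d/d≡1 N))))
    failure≤bound : fraction X ≤ℚ failureBound
    failure≤bound = ℚP.≤-trans (/-≤-cross X (S₁ + S₂ + S₃ + S₄ + Sₘ) N N (*-monoˡ-≤ N cover))
      (subst (ℚ._≤ failureBound) (sym (fraction-five S₁ S₂ S₃ S₄ Sₘ))
        (ℚP.+-mono-≤ (ℚP.+-mono-≤ (ℚP.+-mono-≤ (ℚP.+-mono-≤
          (fraction-≤-term S₁ A τL b₁) (fraction-≤-term S₂ 6 κL b₂)) (fraction-≤-term S₃ 6 κR b₃))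
          (fraction-≤-term S₄ A τR b₄)) (ℚP.≤-trans (/-≤-cross Sₘ 1 N (suc D) bₘ) D≤ε)))

-- Reading off membership and sumset facts from the Boolean encodings of Defs.

memberAt-lookup : {n : ℕ} (A : Subset n) (k : ℕ) (k<n : k < n) → lookup A (fromℕ< k<n) ≡ memberAt A k
memberAt-lookup (b ∷ A) zero (s≤s z≤n) = refl
memberAt-lookup (b ∷ A) (suc k) (s≤s k<n) = memberAt-lookup A k k<n

shifted-member : (n : ℕ) (A : Subset n) (t x : ℤ) (k : ℕ) → x ℤ.- t ≡ + k → k < n →
  shifted n A t x ≡ memberAt A k
shifted-member n A t x k x-t≡k k<n with x ℤ.- t | x-t≡k
... | .(+ k) | refl with k <? n
...   | yes k<n′ = memberAt-lookup A k k<n′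
...   | no k≮n = ⊥-elim (k≮n k<n)

any-intro : (f : ℕ → Bool) (g : ℕ → ℕ) (n k : ℕ) → k < n → f (g k) ≡ true → any f (applyUpTo g n) ≡ true
any-intro f g (suc n) zero _ fk rewrite fk = refl
any-intro f g (suc n) (suc k) (s≤s k<n) fk rewrite any-intro f (λ x → g (suc x)) n k k<n fk = ∨-zeroʳ (f (g 0))

any-false : (f : ℕ → Bool) (g : ℕ → ℕ) (n : ℕ) → (∀ k → k < n → f (g k) ≡ false) → any f (applyUpTo g n) ≡ false
any-false f g zero _ = refl
any-false f g (suc n) none rewrite none 0 (s≤s z≤n) = any-false f (λ x → g (suc x)) n (λ k k<n → none (suc k) (s≤s k<n))

all-counterexample : (f : ℕ → Bool) (g : ℕ → ℕ) (n : ℕ) → all f (applyUpTo g n) ≡ false →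
  ∃ λ k → k < n × f (g k) ≡ false
all-counterexample f g zero ()
all-counterexample f g (suc n) fails with f (g 0) in f0
... | false = 0 , s≤s z≤n , f0
... | true with all-counterexample f (λ x → g (suc x)) n fails
...   | k , k<n , fk = suc k , s≤s k<n , fk

sumset-intro : (m : ℕ) (A : ISet) (i j : ℕ) → i < m → j < m → A (+ i) ≡ true → A (+ j) ≡ true →
  (x : ℤ) → x ≡ + (i + j) → sumset m A x ≡ true
sumset-intro m A i j i<m j<m i∈A j∈A x refl =
  any-intro _ (λ z → z) m i i<m (any-intro _ (λ z → z) m j j<m
    (trans (cong₂ (λ a b → a ∧ b ∧ does ((+ i) ℤ.+ (+ j) ℤ.≟ + (i + j))) i∈A j∈A)
           (dec-true ((+ i) ℤ.+ (+ j) ℤ.≟ + (i + j)) refl)))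

sumset-top : (ℓ′ : ℕ) (A : ISet) → sumset (suc ℓ′) A (+ (suc ℓ′ + ℓ′)) ≡ false
sumset-top ℓ′ A = any-false _ (λ z → z) (suc ℓ′) (λ i i<ℓ → any-false _ (λ z → z) (suc ℓ′) (λ j j<ℓ →
  trans (cong (λ b → A (+ i) ∧ A (+ j) ∧ b)
              (dec-false ((+ i) ℤ.+ (+ j) ℤ.≟ + (suc ℓ′ + ℓ′)) (λ e → too-small i j i<ℓ j<ℓ (ℤP.+-injective e))))
        (ends-false (A (+ i)) (A (+ j)))))
  where
  ends-false : ∀ a b → a ∧ b ∧ false ≡ false
  ends-false a b = trans (cong (a ∧_) (∧-zeroʳ b)) (∧-zeroʳ a)
  too-small : ∀ i j → i < suc ℓ′ → j < suc ℓ′ → i + j ≢ suc ℓ′ + ℓ′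
  too-small i j (s≤s i≤ℓ′) (s≤s j≤ℓ′) e = <-irrefl e (s≤s (+-mono-≤ i≤ℓ′ j≤ℓ′))

empty-interval : ∀ lo hi (X : ISet) → hi ≡ ℤ.pred lo → Intv⊆ lo hi X
empty-interval lo hi X hi≡ x lo≤x x≤hi =
  ⊥-elim (ℤP.<-irrefl refl (ℤP.i≤pred[j]⇒i<j (subst (lo ℤ.≤_) hi≡ (ℤP.≤-trans lo≤x x≤hi))))

marked-shift : ∀ (f : ℕ → Bool) d → marked f (suc d) ≡ bit (f 0) + marked (λ i → f (suc i)) d
marked-shift f zero = +-comm 0 (bit (f 0))
marked-shift f (suc d) = trans (cong (_+ bit (f (suc d))) (marked-shift f d)) (+-assoc (bit (f 0)) _ _)

countList-applyUpTo : ∀ (Q : ℕ → Bool) (g : ℕ → ℕ) d → countList Q (applyUpTo g d) ≡ marked (λ i → Q (g i)) d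
countList-applyUpTo Q g zero = refl
countList-applyUpTo Q g (suc d) = trans (countList-cons Q (g 0) (applyUpTo (λ i → g (suc i)) d))
  (trans (cong (_+_ (bit (Q (g 0)))) (countList-applyUpTo Q (λ i → g (suc i)) d))
         (sym (marked-shift (λ i → Q (g i)) d)))

marked-ext : ∀ (f g : ℕ → Bool) d → (∀ i → i < d → f i ≡ g i) → marked f d ≡ marked g d
marked-ext f g zero _ = refl
marked-ext f g (suc d) f≡g = cong₂ _+_ (marked-ext f g d (λ i i<d → f≡g i (m≤n⇒m≤1+n i<d))) (cong bit (f≡g d ≤-refl))

marked-split : ∀ (f : ℕ → Bool) a b → marked f (a + b) ≡ marked f a + marked (λ v → f (a + v)) b
marked-split f a zero = trans (cong (marked f) (+-identityʳ a)) (sym (+-identityʳ _))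
marked-split f a (suc b) rewrite +-suc a b =
  trans (cong (_+ bit (f (a + b))) (marked-split f a b)) (+-assoc (marked f a) _ _)

marked-none : ∀ (f : ℕ → Bool) d → (∀ i → i < d → f i ≡ false) → marked f d ≡ 0
marked-none f zero _ = refl
marked-none f (suc d) none rewrite none d ≤-refl = trans (+-identityʳ _) (marked-none f d (λ i i<d → none i (m≤n⇒m≤1+n i<d)))

card-marked : ∀ {m} (V : Subset m) → FS.∣ V ∣ ≡ marked (memberAt V) m
card-marked [] = refl
card-marked {suc m} (true ∷ V) = trans (cong suc (card-marked V)) (sym (marked-shift (memberAt (true ∷ V)) m))
card-marked {suc m} (false ∷ V) = trans (card-marked V) (sym (marked-shift (memberAt (false ∷ V)) m))

≤ᵇ-true : ∀ i c → i ≤ c → (i ℕ.≤ᵇ c) ≡ true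
≤ᵇ-true i c i≤c with i ℕ.≤ᵇ c | ≤⇒≤ᵇ i≤c
... | true | _ = refl

≤ᵇ-false : ∀ i c → c < i → (i ℕ.≤ᵇ c) ≡ false
≤ᵇ-false i c c<i with i ℕ.≤ᵇ c in e
... | false = refl
... | true = ⊥-elim (<⇒≱ c<i (≤ᵇ⇒≤ i c (subst T (sym e) _)))

-- The minimal a: a = ℓ + 1 always qualifies (both required intervals are empty),
-- while a ≤ 1 never does (2ℓ - 1 ∉ L + L).  Hence a = A + 2 with 0 ≤ A ≤ ℓ - 1.
module SmallestA (ℓ′ : ℕ) (L R₀ : Subset (suc ℓ′)) (r : ℕ) where
  open Setting (suc ℓ′) L R₀ r

  good-ℓ+1 : GoodA (+ (suc ℓ′ + 1))
  good-ℓ+1 = empty-interval _ _ _ low-empty , empty-interval _ _ _ high-empty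
    where
    low-empty : + 2 ℤ.* ℓℤ ℤ.- + (suc ℓ′ + 1) ≡ ℤ.pred ℓℤ
    low-empty = trans (cong (λ z → + 2 ℤ.* ℓℤ ℤ.- z) (ℤP.pos-+ (suc ℓ′) 1)) (rearrange ℓℤ)
      where
      rearrange : ∀ l → + 2 ℤ.* l ℤ.- (l ℤ.+ + 1) ≡ ℤ.-1ℤ ℤ.+ l
      rearrange = ℤ-Solver.solve-∀
    high-empty : + 2 ℤ.* rℤ ℤ.- ℓℤ ℤ.- + 2 ≡ ℤ.pred (+ 2 ℤ.* rℤ ℤ.- + 2 ℤ.* ℓℤ ℤ.+ + (suc ℓ′ + 1) ℤ.- + 2)
    high-empty = trans (rearrange rℤ ℓℤ)
      (cong (λ z → ℤ.-1ℤ ℤ.+ (+ 2 ℤ.* rℤ ℤ.- + 2 ℤ.* ℓℤ ℤ.+ z ℤ.- + 2)) (sym (ℤP.pos-+ (suc ℓ′) 1)))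
      where
      rearrange : ∀ r l → + 2 ℤ.* r ℤ.- l ℤ.- + 2 ≡ ℤ.-1ℤ ℤ.+ (+ 2 ℤ.* r ℤ.- + 2 ℤ.* l ℤ.+ (l ℤ.+ + 1) ℤ.- + 2)
      rearrange = ℤ-Solver.solve-∀

  not-good : ∀ a d → + 2 ℤ.* ℓℤ ℤ.- a ≡ + (suc ℓ′ + ℓ′ + d) → ¬ GoodA a
  not-good a d top≡ (low , _) = true≢false (trans (sym (low (+ (suc ℓ′ + ℓ′)) (ℤ.+≤+ (m≤m+n (suc ℓ′) ℓ′)) top≥))
                                                   (sumset-top ℓ′ Lset))
    where
    top≥ : + (suc ℓ′ + ℓ′) ℤ.≤ + 2 ℤ.* ℓℤ ℤ.- a
    top≥ = subst (+ (suc ℓ′ + ℓ′) ℤ.≤_) (sym top≡) (ℤ.+≤+ (m≤m+n _ d))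
    true≢false : true ≢ false
    true≢false ()

  top-form : ∀ d → + 2 ℤ.* ℓℤ ℤ.- (+ 1 ℤ.- + d) ≡ + (suc ℓ′ + ℓ′ + d)
  top-form d = trans (cong (λ l → + 2 ℤ.* l ℤ.- (+ 1 ℤ.- + d)) (ℤP.pos-+ 1 ℓ′))
    (trans (rearrange (+ ℓ′) (+ d)) (sym (trans (ℤP.pos-+ (suc ℓ′ + ℓ′) d) (cong (ℤ._+ + d) (ℤP.pos-+ (suc ℓ′) ℓ′)))))
    where
    rearrange : ∀ l d → + 2 ℤ.* (+ 1 ℤ.+ l) ℤ.- (+ 1 ℤ.- d) ≡ (+ 1 ℤ.+ l) ℤ.+ l ℤ.+ d
    rearrange = ℤ-Solver.solve-∀

  smallest-a : (a : ℤ) → IsSmallestA a → ∃ λ A → a ≡ + suc (suc A) × A + 1 ≤ suc ℓ′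
  smallest-a (+ zero) (good , _) = ⊥-elim (not-good (+ 0) 1 (top-form 1) good)
  smallest-a (+ suc zero) (good , _) = ⊥-elim (not-good (+ 1) 0 (top-form 0) good)
  smallest-a -[1+ k ] (good , _) = ⊥-elim (not-good -[1+ k ] (suc (suc k)) (top-form (suc (suc k))) good)
  smallest-a (+ suc (suc A)) (_ , minimal) = A , refl ,
    ≤-trans (≤-reflexive (+-comm A 1)) (≤-trans (≤-pred (ℤP.drop‿+≤+ (minimal (+ (suc ℓ′ + 1)) good-ℓ+1))) (≤-reflexive (+-comm ℓ′ 1)))

anyBelow : {n : ℕ} → (ℕ → Subset n → Bool) → ℕ → Subset n → Bool
anyBelow H zero s = false
anyBelow H (suc K) s = anyBelow H K s ∨ H K s

anyBelow-intro : {n : ℕ} (H : ℕ → Subset n → Bool) (K k : ℕ) (s : Subset n) → k < K → H k s ≡ true →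
  anyBelow H K s ≡ true
anyBelow-intro H (suc K) k s k<K Hk with k ℕ.≟ K
... | yes refl rewrite Hk = ∨-zeroʳ (anyBelow H k s)
... | no k≢K rewrite anyBelow-intro H K k s (≤∧≢⇒< (≤-pred k<K) k≢K) Hk = refl

count-anyBelow : (n : ℕ) (H : ℕ → Subset n → Bool) (K : ℕ) →
  countSubsets n (anyBelow H K) ≤ sumBelow (λ k → countSubsets n (H k)) K
count-anyBelow n H zero = ≤-reflexive (count-false n)
count-anyBelow n H (suc K) =
  ≤-trans (count-∨ n (anyBelow H K) (H K)) (+-monoˡ-≤ (countSubsets n (H K)) (count-anyBelow n H K))

count-AvoidMarked-all : (n : ℕ) (P : ℕ → Bool) (pos : ℕ → ℕ) (d : ℕ) →
  (∀ u → u < d → pos u < n) → (∀ u v → u < d → v < u → pos v ≢ pos u) →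
  2 ^ marked P d * countSubsets n (AvoidMarked P pos d) ≡ 2 ^ n
count-AvoidMarked-all n P pos d in-range injective =
  trans (count-AvoidMarked n P pos d (λ _ → true) in-range injective (λ _ _ _ → refl)) (count-true n)

count-NoMirrorPair-all : (n : ℕ) (pos : ℕ → ℕ) (k : ℕ) →
  (∀ i → InWindow 0 k i → pos i < n) → (∀ i j → InWindow 0 k i → InWindow 0 k j → i ≢ j → pos i ≢ pos j) →
  2 ^ k * countSubsets n (NoMirrorPair pos 0 k) ≡ mirrorWeight k * 2 ^ n
count-NoMirrorPair-all n pos k in-range injective =
  trans (count-NoMirrorPair n pos 0 k (λ _ → true) in-range injective (λ _ _ _ → refl)) (cong (mirrorWeight k *_) (count-true n))

count-NoMirrorPair-AvoidMarked : (n : ℕ) (mpos : ℕ → ℕ) (k : ℕ) (P : ℕ → Bool) (pos : ℕ → ℕ) (d : ℕ) →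
  (∀ i → InWindow 0 k i → mpos i < n) → (∀ i j → InWindow 0 k i → InWindow 0 k j → i ≢ j → mpos i ≢ mpos j) →
  (∀ u → u < d → pos u < n) → (∀ u v → u < d → v < u → pos v ≢ pos u) →
  (∀ i u → InWindow 0 k i → u < d → pos u ≢ mpos i) →
  2 ^ k * (2 ^ marked P d * countSubsets n (λ s → NoMirrorPair mpos 0 k s ∧ AvoidMarked P pos d s))
    ≡ mirrorWeight k * 2 ^ n
count-NoMirrorPair-AvoidMarked n mpos k P pos d m-range m-injective a-range a-injective disjoint = begin
  2 ^ k * (2 ^ marked P d * countSubsets n (λ s → NoMirrorPair mpos 0 k s ∧ Avoid s))
    ≡⟨ cong (λ z → 2 ^ k * (2 ^ marked P d * z)) (count-ext n _ _ (λ s → ∧-comm (NoMirrorPair mpos 0 k s) (Avoid s))) ⟩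
  2 ^ k * (2 ^ marked P d * countSubsets n (λ s → Avoid s ∧ NoMirrorPair mpos 0 k s))
    ≡⟨ swap-front (2 ^ k) (2 ^ marked P d) _ ⟩
  2 ^ marked P d * (2 ^ k * countSubsets n (λ s → Avoid s ∧ NoMirrorPair mpos 0 k s))
    ≡⟨ cong (_*_ (2 ^ marked P d)) (count-NoMirrorPair n mpos 0 k Avoid m-range m-injective
         (λ i w → AvoidMarked-ignores P pos d (mpos i) (λ u u<d → disjoint i u w u<d))) ⟩
  2 ^ marked P d * (mirrorWeight k * countSubsets n Avoid)
    ≡⟨ swap-front (2 ^ marked P d) (mirrorWeight k) _ ⟩
  mirrorWeight k * (2 ^ marked P d * countSubsets n Avoid)
    ≡⟨ cong (_*_ (mirrorWeight k)) (count-AvoidMarked-all n P pos d a-range a-injective) ⟩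
  mirrorWeight k * 2 ^ n ∎
  where
  open ≡-Reasoning
  Avoid = AvoidMarked P pos d
  swap-front : ∀ a b c → a * (b * c) ≡ b * (a * c)
  swap-front = solve-∀

-- The reflection i ↦ m - 1 - i of [0, m); positions near the top of the middle
-- block are addressed through it.
rev : ℕ → ℕ → ℕ
rev m i = m ∸ suc i

rev-+ : ∀ {m i} → i < m → rev m i + suc i ≡ m
rev-+ = m∸n+n≡m

rev-< : ∀ {m i} → i < m → rev m i < m
rev-< {m} {i} i<m = ≤-trans (s≤s (m≤m+n (rev m i) i)) (≤-reflexive (trans (sym (+-suc (rev m i) i)) (rev-+ i<m)))

rev-injective : ∀ {m i j} → i < m → j < m → rev m i ≡ rev m j → i ≡ j
rev-injective i<m j<m e = suc-injective (∸-cancelˡ-≡ i<m j<m e)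

shifted-rev-injective : ∀ k m u v → u < m → v < u → k + rev m v ≢ k + rev m u
shifted-rev-injective k m u v u<m v<u e =
  <-irrefl (rev-injective (<-trans v<u u<m) u<m (+-cancelˡ-≡ k _ _ e)) v<u

∨-introˡ : ∀ {a} b → a ≡ true → a ∨ b ≡ true
∨-introˡ b refl = refl
∨-introʳ : ∀ a {b} → b ≡ true → a ∨ b ≡ true
∨-introʳ a refl = ∨-zeroʳ a

pos-+₃ : ∀ a b d → + (a + b + d) ≡ + a ℤ.+ + b ℤ.+ + d
pos-+₃ a b d = trans (ℤP.pos-+ (a + b) d) (cong (ℤ._+ + d) (ℤP.pos-+ a b))

pos-+-minus : ∀ Z Y → + (Z + Y) ℤ.- + Y ≡ + Z
pos-+-minus Z Y = trans (cong (ℤ._- + Y) (ℤP.pos-+ Z Y)) (rearrange (+ Z) (+ Y))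
  where
  rearrange : ∀ (a b : ℤ) → (a ℤ.+ b) ℤ.- b ≡ a
  rearrange = ℤ-Solver.solve-∀

contrapositive : (G S : Bool) → (G ≡ false → S ≡ true) → not S ≡ true → G ≡ true
contrapositive true S _ _ = refl
contrapositive false S forces notS with forces refl
contrapositive false .true _ () | refl

∧-false : ∀ a b → a ∧ b ≡ false → a ≡ false ⊎ b ≡ false
∧-false false b _ = inj₁ refl
∧-false true b e = inj₂ e

module Layout (ℓ : ℕ) (L R₀ : Subset ℓ) (r : ℕ) (2ℓ≤r : 2 * ℓ ≤ r) where
  open Setting ℓ L R₀ r

  n : ℕ
  n = r ∸ 2 * ℓ

  r≡ : r ≡ ℓ + ℓ + n
  r≡ = trans (sym (m∸n+n≡m 2ℓ≤r)) (rearrange n ℓ)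
    where
    rearrange : ∀ n ℓ → n + 2 * ℓ ≡ ℓ + ℓ + n
    rearrange = solve-∀

  L⊆S : (M : Subset n) (u : ℕ) → u < ℓ → memberAt L u ≡ true → Sset M (+ u) ≡ true
  L⊆S M u u<ℓ u∈L =
    ∨-introˡ _ (∨-introˡ _ (trans (shifted-member ℓ L (+ 0) (+ u) u (cong +_ (+-identityʳ u)) u<ℓ) u∈L))

  M⊆S : (M : Subset n) (p : ℕ) → p < n → memberAt M p ≡ true → Sset M (+ (ℓ + p)) ≡ true
  M⊆S M p p<n p∈M = ∨-introˡ _ (∨-introʳ (Lset (+ (ℓ + p))) (trans (shifted-member n M (+ ℓ) (+ (ℓ + p)) p offset p<n) p∈M))
    where
    rearrange : ∀ (a b : ℤ) → (a ℤ.+ b) ℤ.- a ≡ b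
    rearrange = ℤ-Solver.solve-∀
    offset : + (ℓ + p) ℤ.- + ℓ ≡ + p
    offset = trans (cong (ℤ._- + ℓ) (ℤP.pos-+ ℓ p)) (rearrange (+ ℓ) (+ p))

  rℤ≡ : rℤ ≡ + ℓ ℤ.+ + ℓ ℤ.+ + n
  rℤ≡ = trans (cong +_ r≡) (trans (ℤP.pos-+ (ℓ + ℓ) n) (cong (ℤ._+ + n) (ℤP.pos-+ ℓ ℓ)))

  R-offset : ∀ q → + (ℓ + n + q) ℤ.- (rℤ ℤ.- ℓℤ) ≡ + q
  R-offset q = trans (cong₂ (λ x y → x ℤ.- (y ℤ.- ℓℤ)) (pos-+₃ ℓ n q) rℤ≡) (rearrange (+ ℓ) (+ n) (+ q))
    where
    rearrange : ∀ (a b c : ℤ) → (a ℤ.+ b ℤ.+ c) ℤ.- (a ℤ.+ a ℤ.+ b ℤ.- a) ≡ c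
    rearrange = ℤ-Solver.solve-∀

  R⊆S : (M : Subset n) (q : ℕ) → q < ℓ → memberAt R₀ q ≡ true → Sset M (+ (ℓ + n + q)) ≡ true
  R⊆S M q q<ℓ q∈R₀ = ∨-introʳ (Lset (+ (ℓ + n + q)) ∨ Mset M (+ (ℓ + n + q)))
    (trans (shifted-member ℓ R₀ (rℤ ℤ.- ℓℤ) (+ (ℓ + n + q)) q (R-offset q) q<ℓ) q∈R₀)

  -- every element of S is below r, as the sumset search range requires
  L<r : ∀ u → u < ℓ → u < r
  L<r u u<ℓ = ≤-trans u<ℓ (≤-trans (m≤m+n ℓ (ℓ + n)) (≤-reflexive (trans (sym (+-assoc ℓ ℓ n)) (sym r≡))))
  M<r : ∀ p → p < n → ℓ + p < r
  M<r p p<n = ≤-trans (+-monoʳ-< ℓ p<n) (≤-trans (m≤n+m (ℓ + n) ℓ) (≤-reflexive (trans (sym (+-assoc ℓ ℓ n)) (sym r≡))))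
  R<r : ∀ q → q < ℓ → ℓ + n + q < r
  R<r q q<ℓ = ≤-trans (+-monoʳ-< (ℓ + n) q<ℓ) (≤-reflexive (trans (rearrange ℓ n) (sym r≡)))
    where
    rearrange : ∀ ℓ n → ℓ + n + ℓ ≡ ℓ + ℓ + n
    rearrange = solve-∀

  inSumset : Subset n → ℤ → Bool
  inSumset M x = sumset r (Sset M) x

  L+M : (M : Subset n) (u p : ℕ) → u < ℓ → p < n → memberAt L u ≡ true → memberAt M p ≡ true →
    (x : ℤ) → x ≡ + (u + (ℓ + p)) → inSumset M x ≡ true
  L+M M u p u<ℓ p<n u∈L p∈M = sumset-intro r (Sset M) u (ℓ + p) (L<r u u<ℓ) (M<r p p<n) (L⊆S M u u<ℓ u∈L) (M⊆S M p p<n p∈M)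

  M+M : (M : Subset n) (p p′ : ℕ) → p < n → p′ < n → memberAt M p ≡ true → memberAt M p′ ≡ true →
    (x : ℤ) → x ≡ + ((ℓ + p) + (ℓ + p′)) → inSumset M x ≡ true
  M+M M p p′ p<n p′<n p∈M p′∈M = sumset-intro r (Sset M) (ℓ + p) (ℓ + p′) (M<r p p<n) (M<r p′ p′<n) (M⊆S M p p<n p∈M) (M⊆S M p′ p′<n p′∈M)

  R+M : (M : Subset n) (q p : ℕ) → q < ℓ → p < n → memberAt R₀ q ≡ true → memberAt M p ≡ true →
    (x : ℤ) → x ≡ + ((ℓ + n + q) + (ℓ + p)) → inSumset M x ≡ true
  R+M M q p q<ℓ p<n q∈R₀ p∈M = sumset-intro r (Sset M) (ℓ + n + q) (ℓ + p) (R<r q q<ℓ) (M<r p p<n) (R⊆S M q q<ℓ q∈R₀) (M⊆S M p p<n p∈M)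

  -- With a = A + 2 and ℓ = c + A + 1, the target interval [2ℓ-a+1, 2r-2ℓ+a-3] is covered by
  -- four families of points; for each point x we name an event on M that is forced
  -- when x ∉ S + S, and compute its probability.
  --   lowEdge j  = ℓ + c + j            (j < A)    forces: no u ≤ c in L with x - u ∈ ℓ + M
  --   lowBulk k  = 2ℓ - 1 + k           (k ≤ n)    forces: no mirror pair in ℓ + [0,k), and
  --                                                 no u ∈ L with x - u ∈ ℓ + M (if k + ℓ ≤ n)
  --   highBulk k, highEdge j: the mirror images, with R in place of L.
  module Targets (A c : ℕ) (ℓ≡ : ℓ ≡ c + A + 1) where

    lowEdge lowBulk highBulk highEdge : ℕ → ℤ
    lowEdge j = + (ℓ + c + j)
    lowBulk k = + (ℓ + c + A + k)
    highBulk k = + (ℓ + ℓ + n + n) ℤ.- + (suc k)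
    highEdge j = + (ℓ + ℓ + n + n + A) ℤ.- + (suc j)

    c<ℓ : ∀ {u} → u < suc c → u < ℓ
    c<ℓ u≤c = ≤-trans u≤c (≤-trans (s≤s (m≤m+n c A)) (≤-reflexive (trans (+-comm 1 (c + A)) (sym ℓ≡))))

    A+v<ℓ : ∀ {v} → v < suc c → A + v < ℓ
    A+v<ℓ (s≤s v≤c) = ≤-trans (s≤s (+-monoʳ-≤ A v≤c)) (≤-reflexive (trans (rearrange A c) (sym ℓ≡)))
      where
      rearrange : ∀ A c → suc (A + c) ≡ c + A + 1
      rearrange = solve-∀

    edge<ℓ : ∀ {j v} → j < A → v < suc c → j + v < ℓ
    edge<ℓ {j} {v} j<A v≤c = <-trans (+-monoˡ-< v j<A) (A+v<ℓ v≤c)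

    LowEdgeGood : ℕ → Subset n → Bool
    LowEdgeGood j = AvoidMarked (memberAt L) (λ u → j + rev (suc c) u) (suc c)

    LowEdgeGood-forced : (j : ℕ) → j < A → ℓ ≤ n → (M : Subset n) →
      not (inSumset M (lowEdge j)) ≡ true → LowEdgeGood j M ≡ true
    LowEdgeGood-forced j j<A ℓ≤n M = contrapositive _ _ λ fails →
      let (u , u≤c , u∈L , hit) = AvoidMarked-witness (memberAt L) (λ u → j + rev (suc c) u) (suc c) M fails in
      L+M M u (j + rev (suc c) u) (c<ℓ u≤c) (≤-trans (edge<ℓ j<A (s≤s (m∸n≤m c u))) ℓ≤n) u∈L hit
        (lowEdge j) (cong +_ (sum≡ u u≤c))
      where
      sum≡ : ∀ u → u < suc c → ℓ + c + j ≡ u + (ℓ + (j + rev (suc c) u))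
      sum≡ u (s≤s u≤c) = trans (cong (λ z → ℓ + z + j) (sym (m+[n∸m]≡n u≤c))) (rearrange ℓ u (c ∸ u) j)
        where
        rearrange : ∀ ℓ u w j → ℓ + (u + w) + j ≡ u + (ℓ + (j + w))
        rearrange = solve-∀

    count-LowEdgeGood : (j : ℕ) → j < A → ℓ ≤ n →
      2 ^ marked (memberAt L) (suc c) * countSubsets n (LowEdgeGood j) ≡ 2 ^ n
    count-LowEdgeGood j j<A ℓ≤n = count-AvoidMarked-all n (memberAt L) (λ u → j + rev (suc c) u) (suc c)
      (λ u u≤c → ≤-trans (edge<ℓ j<A (s≤s (m∸n≤m c u))) ℓ≤n)
      (λ u v u≤c v<u → shifted-rev-injective j (suc c) u v u≤c v<u)

    -- a mirror pair i + j = k - 1 in M gives (ℓ + i) + (ℓ + j) = 2ℓ - 1 + k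
    low-mirror-hit : (k : ℕ) → k ≤ n → (M : Subset n) → NoMirrorPair (λ i → i) 0 k M ≡ false →
      inSumset M (lowBulk k) ≡ true
    low-mirror-hit k k≤n M fails with NoMirrorPair-witness (λ i → i) 0 k M fails
    ... | (i , j , (_ , i<k) , (_ , j<k) , i+j+1≡k , i∈M , j∈M) =
      M+M M i j (≤-trans i<k k≤n) (≤-trans j<k k≤n) i∈M j∈M (lowBulk k)
        (cong +_ (trans (cong (λ z → ℓ + c + A + z) (sym i+j+1≡k)) (sum≡ ℓ ℓ≡)))
      where
      sum≡ : ∀ ℓ → ℓ ≡ c + A + 1 → ℓ + c + A + (i + j + 1) ≡ (ℓ + i) + (ℓ + j)
      sum≡ .(c + A + 1) refl = rearrange c A i j
        where
        rearrange : ∀ c A i j → c + A + 1 + c + A + (i + j + 1) ≡ (c + A + 1 + i) + (c + A + 1 + j)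
        rearrange = solve-∀

    LowBulkPairs : ℕ → Subset n → Bool
    LowBulkPairs k = NoMirrorPair (λ i → i) 0 k

    LowBulkPairs-forced : (k : ℕ) → k ≤ n → (M : Subset n) →
      not (inSumset M (lowBulk k)) ≡ true → LowBulkPairs k M ≡ true
    LowBulkPairs-forced k k≤n M = contrapositive _ _ (low-mirror-hit k k≤n M)

    count-LowBulkPairs : (k : ℕ) → k ≤ n → 2 ^ k * countSubsets n (LowBulkPairs k) ≡ mirrorWeight k * 2 ^ n
    count-LowBulkPairs k k≤n =
      count-NoMirrorPair-all n (λ i → i) k (λ i (_ , i<k) → ≤-trans i<k k≤n) (λ i j _ _ i≢j → i≢j)

    LowBulkGood : ℕ → Subset n → Bool
    LowBulkGood k M = NoMirrorPair (λ i → i) 0 k M ∧ AvoidMarked (memberAt L) (λ u → k + rev ℓ u) ℓ M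

    LowBulkGood-forced : (k : ℕ) → k + ℓ ≤ n → (M : Subset n) →
      not (inSumset M (lowBulk k)) ≡ true → LowBulkGood k M ≡ true
    LowBulkGood-forced k kℓ≤n M = contrapositive _ _ λ fails →
      [ low-mirror-hit k (≤-trans (m≤m+n k ℓ) kℓ≤n) M , L-hit ] (∧-false _ _ fails)
      where
      L-hit : AvoidMarked (memberAt L) (λ u → k + rev ℓ u) ℓ M ≡ false → inSumset M (lowBulk k) ≡ true
      L-hit fails with AvoidMarked-witness (memberAt L) (λ u → k + rev ℓ u) ℓ M fails
      ... | (u , u<ℓ , u∈L , hit) =
        L+M M u (k + rev ℓ u) u<ℓ (≤-trans (+-monoʳ-< k (rev-< u<ℓ)) kℓ≤n) u∈L hit (lowBulk k)
          (cong +_ (sum≡ ℓ ℓ≡ (rev-+ u<ℓ)))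
        where
        sum≡ : ∀ ℓ → ℓ ≡ c + A + 1 → rev ℓ u + suc u ≡ ℓ → ℓ + c + A + k ≡ u + (ℓ + (k + rev ℓ u))
        sum≡ ℓ ℓ≡′ w+u≡ℓ = begin
          ℓ + c + A + k                        ≡⟨ cong (_+ k) (+-assoc ℓ c A) ⟩
          ℓ + (c + A) + k                      ≡⟨ cong (λ z → ℓ + z + k) (suc-injective (trans (+-comm 1 (c + A)) (trans (sym ℓ≡′) (sym w+u≡ℓ′)))) ⟩
          ℓ + (rev ℓ u + u) + k                ≡⟨ cong (λ z → z + (rev ℓ u + u) + k) (sym w+u≡ℓ′) ⟩
          suc (rev ℓ u + u) + (rev ℓ u + u) + k ≡⟨ rearrange (rev ℓ u) u k ⟩
          u + (suc (rev ℓ u + u) + (k + rev ℓ u)) ≡⟨ cong (λ z → u + (z + (k + rev ℓ u))) w+u≡ℓ′ ⟩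
          u + (ℓ + (k + rev ℓ u))              ∎
          where
          open ≡-Reasoning
          w+u≡ℓ′ : suc (rev ℓ u + u) ≡ ℓ
          w+u≡ℓ′ = trans (sym (+-suc (rev ℓ u) u)) w+u≡ℓ
          rearrange : ∀ w u k → suc (w + u) + (w + u) + k ≡ u + (suc (w + u) + (k + w))
          rearrange = solve-∀

    count-LowBulkGood : (k : ℕ) → k + ℓ ≤ n →
      2 ^ k * (2 ^ marked (memberAt L) ℓ * countSubsets n (LowBulkGood k)) ≡ mirrorWeight k * 2 ^ n
    count-LowBulkGood k kℓ≤n = count-NoMirrorPair-AvoidMarked n (λ i → i) k (memberAt L) (λ u → k + rev ℓ u) ℓ
      (λ i (_ , i<k) → ≤-trans i<k (≤-trans (m≤m+n k ℓ) kℓ≤n)) (λ i j _ _ i≢j → i≢j)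
      (λ u u<ℓ → ≤-trans (+-monoʳ-< k (rev-< u<ℓ)) kℓ≤n) (shifted-rev-injective k ℓ)
      (λ i u (_ , i<k) _ e → <-irrefl (sym e) (≤-trans i<k (m≤m+n k _)))

    -- a mirror pair i + j = k - 1 gives (ℓ + rev n i) + (ℓ + rev n j) = 2ℓ + 2n - (k + 1)
    high-mirror-hit : (k : ℕ) → k ≤ n → (M : Subset n) → NoMirrorPair (rev n) 0 k M ≡ false →
      inSumset M (highBulk k) ≡ true
    high-mirror-hit k k≤n M fails with NoMirrorPair-witness (rev n) 0 k M fails
    ... | (i , j , (_ , i<k) , (_ , j<k) , i+j+1≡k , i∈M , j∈M) =
      M+M M (rev n i) (rev n j) (rev-< i<n) (rev-< j<n) i∈M j∈M (highBulk k)
        (trans (cong (λ z → z ℤ.- + (suc k)) (cong +_ sum≡)) (pos-+-minus _ (suc k)))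
      where
      i<n = ≤-trans i<k k≤n
      j<n = ≤-trans j<k k≤n
      rearrange : ∀ ℓ p q i j → ℓ + ℓ + (p + suc i) + (q + suc j) ≡ ((ℓ + p) + (ℓ + q)) + suc (i + j + 1)
      rearrange = solve-∀
      sum≡ : ℓ + ℓ + n + n ≡ ((ℓ + rev n i) + (ℓ + rev n j)) + suc k
      sum≡ = trans (cong₂ (λ a b → ℓ + ℓ + a + b) (sym (rev-+ i<n)) (sym (rev-+ j<n)))
        (trans (rearrange ℓ (rev n i) (rev n j) i j) (cong (λ z → ((ℓ + rev n i) + (ℓ + rev n j)) + suc z) i+j+1≡k))

    HighBulkPairs : ℕ → Subset n → Bool
    HighBulkPairs k = NoMirrorPair (rev n) 0 k

    HighBulkPairs-forced : (k : ℕ) → k ≤ n → (M : Subset n) →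
      not (inSumset M (highBulk k)) ≡ true → HighBulkPairs k M ≡ true
    HighBulkPairs-forced k k≤n M = contrapositive _ _ (high-mirror-hit k k≤n M)

    rev-window : ∀ k → k ≤ n → ∀ i j → InWindow 0 k i → InWindow 0 k j → i ≢ j → rev n i ≢ rev n j
    rev-window k k≤n i j (_ , i<k) (_ , j<k) i≢j e = i≢j (rev-injective (≤-trans i<k k≤n) (≤-trans j<k k≤n) e)

    count-HighBulkPairs : (k : ℕ) → k ≤ n → 2 ^ k * countSubsets n (HighBulkPairs k) ≡ mirrorWeight k * 2 ^ n
    count-HighBulkPairs k k≤n =
      count-NoMirrorPair-all n (rev n) k (λ i (_ , i<k) → rev-< (≤-trans i<k k≤n)) (rev-window k k≤n)

    HighBulkGood : ℕ → Subset n → Bool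
    HighBulkGood k M = NoMirrorPair (rev n) 0 k M ∧ AvoidMarked (memberAt R₀) (λ q → rev n (k + q)) ℓ M

    HighBulkGood-forced : (k : ℕ) → k + ℓ ≤ n → (M : Subset n) →
      not (inSumset M (highBulk k)) ≡ true → HighBulkGood k M ≡ true
    HighBulkGood-forced k kℓ≤n M = contrapositive _ _ λ fails →
      [ high-mirror-hit k (≤-trans (m≤m+n k ℓ) kℓ≤n) M , R-hit ] (∧-false _ _ fails)
      where
      R-hit : AvoidMarked (memberAt R₀) (λ q → rev n (k + q)) ℓ M ≡ false → inSumset M (highBulk k) ≡ true
      R-hit fails with AvoidMarked-witness (memberAt R₀) (λ q → rev n (k + q)) ℓ M fails
      ... | (q , q<ℓ , q∈R₀ , hit) =
        R+M M q (rev n (k + q)) q<ℓ (rev-< kq<n) q∈R₀ hit (highBulk k)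
          (trans (cong (λ z → z ℤ.- + (suc k)) (cong +_ sum≡)) (pos-+-minus _ (suc k)))
        where
        kq<n : k + q < n
        kq<n = ≤-trans (+-monoʳ-< k q<ℓ) kℓ≤n
        rearrange : ∀ ℓ n p k q → ℓ + ℓ + n + (p + suc (k + q)) ≡ ((ℓ + n + q) + (ℓ + p)) + suc k
        rearrange = solve-∀
        sum≡ : ℓ + ℓ + n + n ≡ ((ℓ + n + q) + (ℓ + rev n (k + q))) + suc k
        sum≡ = trans (cong (λ a → ℓ + ℓ + n + a) (sym (rev-+ kq<n))) (rearrange ℓ n (rev n (k + q)) k q)

    count-HighBulkGood : (k : ℕ) → k + ℓ ≤ n →
      2 ^ k * (2 ^ marked (memberAt R₀) ℓ * countSubsets n (HighBulkGood k)) ≡ mirrorWeight k * 2 ^ n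
    count-HighBulkGood k kℓ≤n = count-NoMirrorPair-AvoidMarked n (rev n) k (memberAt R₀) (λ q → rev n (k + q)) ℓ
      (λ i (_ , i<k) → rev-< (≤-trans i<k k≤n)) (rev-window k k≤n)
      (λ q q<ℓ → rev-< (kq<n q<ℓ))
      (λ u v u<ℓ v<u e → <-irrefl (+-cancelˡ-≡ k _ _ (rev-injective (kq<n (<-trans v<u u<ℓ)) (kq<n u<ℓ) e)) v<u)
      (λ i u (_ , i<k) u<ℓ e → <-irrefl (sym (rev-injective (kq<n u<ℓ) (≤-trans i<k k≤n) e)) (≤-trans i<k (m≤m+n k u)))
      where
      k≤n = ≤-trans (m≤m+n k ℓ) kℓ≤n
      kq<n : ∀ {q} → q < ℓ → k + q < n
      kq<n q<ℓ = ≤-trans (+-monoʳ-< k q<ℓ) kℓ≤n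

    HighEdgeGood : ℕ → Subset n → Bool
    HighEdgeGood j = AvoidMarked (λ v → memberAt R₀ (A + v)) (λ v → rev n (j + v)) (suc c)

    HighEdgeGood-forced : (j : ℕ) → j < A → ℓ ≤ n → (M : Subset n) →
      not (inSumset M (highEdge j)) ≡ true → HighEdgeGood j M ≡ true
    HighEdgeGood-forced j j<A ℓ≤n M = contrapositive _ _ λ fails →
      let (v , v≤c , Av∈R₀ , hit) = AvoidMarked-witness (λ v → memberAt R₀ (A + v)) (λ v → rev n (j + v)) (suc c) M fails in
      R+M M (A + v) (rev n (j + v)) (A+v<ℓ v≤c) (rev-< (jv<n v≤c)) Av∈R₀ hit (highEdge j)
        (trans (cong (λ z → z ℤ.- + (suc j)) (cong +_ (sum≡ v v≤c))) (pos-+-minus _ (suc j)))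
      where
      jv<n : ∀ {v} → v < suc c → j + v < n
      jv<n v≤c = ≤-trans (edge<ℓ j<A v≤c) ℓ≤n
      rearrange : ∀ ℓ n p j v A → ℓ + ℓ + n + (p + suc (j + v)) + A ≡ ((ℓ + n + (A + v)) + (ℓ + p)) + suc j
      rearrange = solve-∀
      sum≡ : ∀ v → v < suc c → ℓ + ℓ + n + n + A ≡ ((ℓ + n + (A + v)) + (ℓ + rev n (j + v))) + suc j
      sum≡ v v≤c = trans (cong (λ a → ℓ + ℓ + n + a + A) (sym (rev-+ (jv<n v≤c)))) (rearrange ℓ n (rev n (j + v)) j v A)

    count-HighEdgeGood : (j : ℕ) → j < A → ℓ ≤ n →
      2 ^ marked (λ v → memberAt R₀ (A + v)) (suc c) * countSubsets n (HighEdgeGood j) ≡ 2 ^ n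
    count-HighEdgeGood j j<A ℓ≤n = count-AvoidMarked-all n (λ v → memberAt R₀ (A + v)) (λ v → rev n (j + v)) (suc c)
      (λ v v≤c → rev-< (jv<n v≤c))
      (λ u v u≤c v<u e → <-irrefl (+-cancelˡ-≡ j _ _ (rev-injective (jv<n (<-trans v<u u≤c)) (jv<n u≤c) e)) v<u)
      where
      jv<n : ∀ {v} → v < suc c → j + v < n
      jv<n v≤c = ≤-trans (edge<ℓ j<A v≤c) ℓ≤n

    a : ℤ
    a = + suc (suc A)

    ℓℤ≡ : + ℓ ≡ + c ℤ.+ + A ℤ.+ + 1
    ℓℤ≡ = trans (cong +_ ℓ≡) (pos-+₃ c A 1)

    ℓ≡suc-c+A : ℓ ≡ suc c + A
    ℓ≡suc-c+A = trans ℓ≡ (rearrange c A)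
      where
      rearrange : ∀ c A → c + A + 1 ≡ suc c + A
      rearrange = solve-∀

    τL≡ : τL a ≡ marked (memberAt L) (suc c)
    τL≡ = begin
      τL a
        ≡⟨ countList-applyUpTo (λ i → Lset (+ i) ∧ ((+ i) ℤ.≤ᵇ (ℓℤ ℤ.- a ℤ.+ + 1))) (λ i → i) ℓ ⟩
      marked (λ i → Lset (+ i) ∧ ((+ i) ℤ.≤ᵇ (ℓℤ ℤ.- a ℤ.+ + 1))) ℓ
        ≡⟨ marked-ext _ _ ℓ (λ i i<ℓ → cong₂ _∧_ (Lset≡ i i<ℓ) (cong ((+ i) ℤ.≤ᵇ_) threshold)) ⟩
      marked (λ i → memberAt L i ∧ (i ℕ.≤ᵇ c)) ℓ
        ≡⟨ cong (marked (λ i → memberAt L i ∧ (i ℕ.≤ᵇ c))) ℓ≡suc-c+A ⟩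
      marked (λ i → memberAt L i ∧ (i ℕ.≤ᵇ c)) (suc c + A)
        ≡⟨ marked-split _ (suc c) A ⟩
      marked (λ i → memberAt L i ∧ (i ℕ.≤ᵇ c)) (suc c) + marked (λ v → memberAt L (suc c + v) ∧ (suc c + v ℕ.≤ᵇ c)) A
        ≡⟨ cong₂ _+_ (marked-ext _ _ (suc c) (λ i i<suc-c → trans (cong (memberAt L i ∧_) (≤ᵇ-true i c (≤-pred i<suc-c))) (∧-identityʳ _)))
                     (marked-none _ A (λ v _ → trans (cong (memberAt L (suc c + v) ∧_) (≤ᵇ-false (suc c + v) c (s≤s (m≤m+n c v))))
                                                     (∧-zeroʳ _))) ⟩
      marked (memberAt L) (suc c) + 0
        ≡⟨ +-identityʳ _ ⟩
      marked (memberAt L) (suc c) ∎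
      where
      open ≡-Reasoning
      threshold : ℓℤ ℤ.- a ℤ.+ + 1 ≡ + c
      threshold = trans (cong (λ z → z ℤ.- a ℤ.+ + 1) ℓℤ≡) (rearrange (+ c) (+ A))
        where
        rearrange : ∀ c A → c ℤ.+ A ℤ.+ + 1 ℤ.- (+ 2 ℤ.+ A) ℤ.+ + 1 ≡ c
        rearrange = ℤ-Solver.solve-∀
      Lset≡ : ∀ i → i < ℓ → Lset (+ i) ≡ memberAt L i
      Lset≡ i i<ℓ = shifted-member ℓ L (+ 0) (+ i) i (cong +_ (+-identityʳ i)) i<ℓ

    τR≡ : τR a ≡ marked (λ v → memberAt R₀ (A + v)) (suc c)
    τR≡ = begin
      τR a
        ≡⟨ countList-applyUpTo (λ i → Rset (+ i) ∧ ((rℤ ℤ.- ℓℤ ℤ.+ a ℤ.- + 2) ℤ.≤ᵇ (+ i))) (λ i → i) r ⟩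
      marked (λ i → Rset (+ i) ∧ ((rℤ ℤ.- ℓℤ ℤ.+ a ℤ.- + 2) ℤ.≤ᵇ (+ i))) r
        ≡⟨ marked-ext _ _ r (λ i _ → cong (λ z → Rset (+ i) ∧ (z ℤ.≤ᵇ (+ i))) threshold) ⟩
      marked inR r
        ≡⟨ cong (marked inR) r≡′ ⟩
      marked inR (ℓ + n + A + suc c)
        ≡⟨ marked-split inR (ℓ + n + A) (suc c) ⟩
      marked inR (ℓ + n + A) + marked (λ v → inR (ℓ + n + A + v)) (suc c)
        ≡⟨ cong₂ _+_
             (marked-none _ (ℓ + n + A) (λ i i< → trans (cong (Rset (+ i) ∧_) (≤ᵇ-false (ℓ + n + A) i i<)) (∧-zeroʳ _)))
             (marked-ext _ _ (suc c) (λ v v≤c → trans (cong₂ _∧_ (Rset≡ v v≤c) (≤ᵇ-true (ℓ + n + A) (ℓ + n + A + v) (m≤m+n _ v)))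
                                                     (∧-identityʳ _))) ⟩
      0 + marked (λ v → memberAt R₀ (A + v)) (suc c) ∎
      where
      open ≡-Reasoning
      inR : ℕ → Bool
      inR i = Rset (+ i) ∧ ((ℓ + n + A) ℕ.≤ᵇ i)
      threshold : rℤ ℤ.- ℓℤ ℤ.+ a ℤ.- + 2 ≡ + (ℓ + n + A)
      threshold = trans (cong (λ x → x ℤ.- ℓℤ ℤ.+ a ℤ.- + 2) rℤ≡) (trans (rearrange (+ ℓ) (+ n) (+ A)) (sym (pos-+₃ ℓ n A)))
        where
        rearrange : ∀ l n A → l ℤ.+ l ℤ.+ n ℤ.- l ℤ.+ (+ 2 ℤ.+ A) ℤ.- + 2 ≡ l ℤ.+ n ℤ.+ A
        rearrange = ℤ-Solver.solve-∀
      r≡′ : r ≡ ℓ + n + A + suc c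
      r≡′ = trans r≡ (trans (cong (λ z → z + z + n) ℓ≡) (trans (rearrange c A n) (cong (λ z → z + n + A + suc c) (sym ℓ≡))))
        where
        rearrange : ∀ c A n → c + A + 1 + (c + A + 1) + n ≡ c + A + 1 + n + A + suc c
        rearrange = solve-∀
      Rset≡ : ∀ v → v < suc c → Rset (+ (ℓ + n + A + v)) ≡ memberAt R₀ (A + v)
      Rset≡ v v≤c = trans (cong Rset (cong +_ (+-assoc (ℓ + n) A v)))
        (shifted-member ℓ R₀ (rℤ ℤ.- ℓℤ) (+ (ℓ + n + (A + v))) (A + v) (R-offset (A + v)) (A+v<ℓ v≤c))

    W : ℕ
    W = n + n + A + A

    lo≡ : + 2 ℤ.* ℓℤ ℤ.- a ℤ.+ + 1 ≡ + (ℓ + c)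
    lo≡ = trans (cong (λ x → + 2 ℤ.* x ℤ.- a ℤ.+ + 1) ℓℤ≡)
      (trans (rearrange (+ c) (+ A)) (sym (trans (ℤP.pos-+ ℓ c) (cong (ℤ._+ + c) ℓℤ≡))))
      where
      rearrange : ∀ c A → + 2 ℤ.* (c ℤ.+ A ℤ.+ + 1) ℤ.- (+ 2 ℤ.+ A) ℤ.+ + 1 ≡ c ℤ.+ A ℤ.+ + 1 ℤ.+ c
      rearrange = ℤ-Solver.solve-∀

    hi≡ : + 2 ℤ.* rℤ ℤ.- + 2 ℤ.* ℓℤ ℤ.+ a ℤ.- + 3 ≡ + (ℓ + c + W)
    hi≡ = trans (cong (λ x → + 2 ℤ.* x ℤ.- + 2 ℤ.* ℓℤ ℤ.+ a ℤ.- + 3) rℤ≡)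
      (trans (cong (λ z → + 2 ℤ.* (z ℤ.+ z ℤ.+ + n) ℤ.- + 2 ℤ.* z ℤ.+ (+ 2 ℤ.+ + A) ℤ.- + 3) ℓℤ≡)
      (trans (rearrange (+ c) (+ A) (+ n)) (sym expand)))
      where
      rearrange : ∀ c A n → + 2 ℤ.* ((c ℤ.+ A ℤ.+ + 1) ℤ.+ (c ℤ.+ A ℤ.+ + 1) ℤ.+ n) ℤ.- + 2 ℤ.* (c ℤ.+ A ℤ.+ + 1)
                              ℤ.+ (+ 2 ℤ.+ A) ℤ.- + 3 ≡ (c ℤ.+ A ℤ.+ + 1) ℤ.+ c ℤ.+ (n ℤ.+ n ℤ.+ A ℤ.+ A)
      rearrange = ℤ-Solver.solve-∀
      expand : + (ℓ + c + W) ≡ (+ c ℤ.+ + A ℤ.+ + 1) ℤ.+ + c ℤ.+ (+ n ℤ.+ + n ℤ.+ + A ℤ.+ + A)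
      expand = trans (ℤP.pos-+ (ℓ + c) W) (cong₂ ℤ._+_ (trans (ℤP.pos-+ ℓ c) (cong (ℤ._+ + c) ℓℤ≡))
                 (trans (ℤP.pos-+ (n + n + A) A) (cong (ℤ._+ + A) (pos-+₃ n n A))))

    interval-size : intvSize (+ 2 ℤ.* ℓℤ ℤ.- a ℤ.+ + 1) (+ 2 ℤ.* rℤ ℤ.- + 2 ℤ.* ℓℤ ℤ.+ a ℤ.- + 3) ≡ suc W
    interval-size rewrite lo≡ | hi≡ =
      trans (cong (λ b → if b then suc ℤ.∣ + (ℓ + c + W) ℤ.- + (ℓ + c) ∣ else 0) (≤ᵇ-true (ℓ + c) (ℓ + c + W) (m≤m+n _ W)))
            (cong (λ z → suc ℤ.∣ z ∣) (trans (cong (λ z → + z ℤ.- + (ℓ + c)) (+-comm (ℓ + c) W)) (pos-+-minus W (ℓ + c))))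

    highEdge-at : ∀ t j → t + j ≡ W → highEdge j ≡ + (ℓ + c + t)
    highEdge-at t j t+j≡W = trans (cong (λ z → z ℤ.- + suc j) (cong +_ sum≡)) (pos-+-minus (ℓ + c + t) (suc j))
      where
      rearrange : ∀ ℓ c A n → ℓ + (c + A + 1) + n + n + A ≡ ℓ + c + (n + n + A + A) + 1
      rearrange = solve-∀
      rearrange′ : ∀ ℓ c t j → ℓ + c + (t + j) + 1 ≡ (ℓ + c + t) + suc j
      rearrange′ = solve-∀
      sum≡ : ℓ + ℓ + n + n + A ≡ (ℓ + c + t) + suc j
      sum≡ = trans (cong (λ z → ℓ + z + n + n + A) ℓ≡)
        (trans (rearrange ℓ c A n) (trans (cong (λ z → ℓ + c + z + 1) (sym t+j≡W)) (rearrange′ ℓ c t j)))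

    highBulk-at : ∀ t k → t + (A + k) ≡ W → highBulk k ≡ + (ℓ + c + t)
    highBulk-at t k t+A+k≡W = trans (cong (λ z → z ℤ.- + suc k) (cong +_ sum≡)) (pos-+-minus (ℓ + c + t) (suc k))
      where
      rearrange : ∀ ℓ c A n → ℓ + (c + A + 1) + n + n + A ≡ ℓ + c + (n + n + A + A) + 1
      rearrange = solve-∀
      rearrange′ : ∀ ℓ c t A k → ℓ + c + (t + (A + k)) + 1 ≡ (ℓ + c + t) + suc k + A
      rearrange′ = solve-∀
      sum≡ : ℓ + ℓ + n + n ≡ (ℓ + c + t) + suc k
      sum≡ = +-cancelʳ-≡ A _ _ (trans (cong (λ z → ℓ + z + n + n + A) ℓ≡)
        (trans (rearrange ℓ c A n) (trans (cong (λ z → ℓ + c + z + 1) (sym t+A+k≡W)) (rearrange′ ℓ c t A k))))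

    missLowEdge missLowBulk missHighBulk missHighEdge : ℕ → Subset n → Bool
    missLowEdge j M = not (inSumset M (lowEdge j))
    missLowBulk k M = not (inSumset M (lowBulk k))
    missHighBulk k M = not (inSumset M (highBulk k))
    missHighEdge j M = not (inSumset M (highEdge j))

    LowMissing HighMissing SomeTargetMissing : Subset n → Bool
    LowMissing M = anyBelow missLowEdge A M ∨ anyBelow missLowBulk (suc n) M
    HighMissing M = anyBelow missHighBulk n M ∨ anyBelow missHighEdge A M
    SomeTargetMissing M = LowMissing M ∨ HighMissing M

    event-fails : (M : Subset n) → Event a M ≡ false → SomeTargetMissing M ≡ true
    event-fails M fails with all-counterexample (λ k → inSumset M (+ 2 ℤ.* ℓℤ ℤ.- a ℤ.+ + 1 ℤ.+ + k)) (λ z → z)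
                               (intvSize (+ 2 ℤ.* ℓℤ ℤ.- a ℤ.+ + 1) (+ 2 ℤ.* rℤ ℤ.- + 2 ℤ.* ℓℤ ℤ.+ a ℤ.- + 3)) fails
    ... | (t , t<size , missing₀) = classify
      where
      missing : not (inSumset M (+ (ℓ + c + t))) ≡ true
      missing = cong not (trans (cong (inSumset M) (trans (ℤP.pos-+ (ℓ + c) t) (cong (ℤ._+ + t) (sym lo≡)))) missing₀)
      t≤W : t ≤ W
      t≤W = ≤-pred (≤-trans t<size (≤-reflexive interval-size))
      classify : SomeTargetMissing M ≡ true
      classify with t <? A
      ... | yes t<A = ∨-introˡ (HighMissing M) (∨-introˡ (anyBelow missLowBulk (suc n) M) (anyBelow-intro missLowEdge A t M t<A missing))
      ... | no t≮A with (t ∸ A) ≤? n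
      ...   | yes k≤n = ∨-introˡ (HighMissing M) (∨-introʳ (anyBelow missLowEdge A M) (anyBelow-intro missLowBulk (suc n) (t ∸ A) M (s≤s k≤n)
                          (subst (λ x → not (inSumset M x) ≡ true) (cong +_ (sym t≡)) missing)))
        where
        t≡ : ℓ + c + A + (t ∸ A) ≡ ℓ + c + t
        t≡ = trans (+-assoc (ℓ + c) A (t ∸ A)) (cong (_+_ (ℓ + c)) (m+[n∸m]≡n (≮⇒≥ t≮A)))
      ...   | no k≰n with (W ∸ t) <? A
      ...     | yes j<A = ∨-introʳ (LowMissing M) (∨-introʳ (anyBelow missHighBulk n M) (anyBelow-intro missHighEdge A (W ∸ t) M j<A
                            (subst (λ x → not (inSumset M x) ≡ true) (sym (highEdge-at t (W ∸ t) (m+[n∸m]≡n t≤W))) missing)))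
      ...     | no j≮A = ∨-introʳ (LowMissing M) (∨-introˡ (anyBelow missHighEdge A M) (anyBelow-intro missHighBulk n k′ M k′<n
                           (subst (λ x → not (inSumset M x) ≡ true) (sym (highBulk-at t k′ t+A+k′≡W)) missing)))
        where
        k′ = (W ∸ t) ∸ A
        t+A+k′≡W : t + (A + k′) ≡ W
        t+A+k′≡W = trans (cong (_+_ t) (m+[n∸m]≡n (≮⇒≥ j≮A))) (m+[n∸m]≡n t≤W)
        -- (t - A) + k′ = 2n and t - A > n, so k′ < n
        k′+k≡2n : k′ + (t ∸ A) ≡ n + n
        k′+k≡2n = +-cancelʳ-≡ (A + A) _ _ (trans (rearrange A (t ∸ A) k′)
          (trans (cong (_+ (A + k′)) (m+[n∸m]≡n (≮⇒≥ t≮A))) (trans t+A+k′≡W (+-assoc (n + n) A A))))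
          where
          rearrange : ∀ A k k′ → k′ + k + (A + A) ≡ (A + k) + (A + k′)
          rearrange = solve-∀
        k′<n : k′ < n
        k′<n = +-cancelʳ-≤ n (suc k′) n (≤-trans (≤-reflexive (sym (+-suc k′ n)))
                 (≤-trans (+-monoʳ-≤ k′ (≰⇒> k≰n)) (≤-reflexive k′+k≡2n)))

-- The estimate for fixed ℓ, L, R₀, r and a = A + 2.  The middle block has n ≥ ℓ + 2h,
-- where h is large enough that (3/4)^h ≤ 1 / (2ℓ(D+1)).  The failure count is split by
-- the union bound into: edge terms (≤ A 2^-τ each side), bulk terms k ≤ n - ℓ with both
-- the mirror and the L/R constraint (geometric series, ≤ 6 · 2^-|L| resp. 6 · 2^-|R|),
-- and at most 2ℓ bulk terms k > n - ℓ ≥ 2h bounded by (3/4)^h each (total ≤ 1/(D+1)).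
module Estimate (ℓ : ℕ) (1≤ℓ : 1 ≤ ℓ) (L R₀ : Subset ℓ) (r : ℕ) (2ℓ≤r : 2 * ℓ ≤ r) (A c : ℕ) (ℓ≡ : ℓ ≡ c + A + 1)
                (D h : ℕ) (decay : 3 ^ h * ((ℓ + ℓ) * suc D) ≤ 4 ^ h) (n-large : ℓ + (h + h) ≤ r ∸ 2 * ℓ) where
  open Setting ℓ L R₀ r
  open Layout ℓ L R₀ r 2ℓ≤r
  open Targets A c ℓ≡

  N Q m : ℕ
  N = 2 ^ n
  Q = (ℓ + ℓ) * suc D
  m = n ∸ ℓ

  ℓ≤n : ℓ ≤ n
  ℓ≤n = ≤-trans (m≤m+n ℓ (h + h)) n-large

  n≡m+ℓ : n ≡ m + ℓ
  n≡m+ℓ = sym (m∸n+n≡m ℓ≤n)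

  n≡suc-m+c+A : n ≡ suc m + (c + A)
  n≡suc-m+c+A = trans n≡m+ℓ (trans (cong (_+_ m) ℓ≡) (rearrange m c A))
    where
    rearrange : ∀ m c A → m + (c + A + 1) ≡ suc m + (c + A)
    rearrange = solve-∀

  2h≤m : h + h ≤ m
  2h≤m = +-cancelʳ-≤ ℓ (h + h) m (≤-trans (≤-reflexive (+-comm (h + h) ℓ)) (≤-trans n-large (≤-reflexive n≡m+ℓ)))

  failures good : ℕ
  failures = countSubsets n (λ M → not (Event a M))
  good = countSubsets n (Event a)

  good+failures : good + failures ≡ N
  good+failures = trans (sym (count-split n (λ _ → true) (Event a))) (count-true n)

  missing-count : ℕ → (ℕ → Subset n → Bool) → ℕ
  missing-count K H = sumBelow (λ k → countSubsets n (H k)) K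

  union-bound : failures ≤ (missing-count A missLowEdge + missing-count (suc n) missLowBulk)
                          + (missing-count n missHighBulk + missing-count A missHighEdge)
  union-bound = ≤-trans (count-mono n _ SomeTargetMissing (λ M e → event-fails M (not-true e)))
    (≤-trans (count-∨ n LowMissing HighMissing)
      (+-mono-≤ (≤-trans (count-∨ n (anyBelow missLowEdge A) (anyBelow missLowBulk (suc n)))
                         (+-mono-≤ (count-anyBelow n missLowEdge A) (count-anyBelow n missLowBulk (suc n))))
                (≤-trans (count-∨ n (anyBelow missHighBulk n) (anyBelow missHighEdge A))
                         (+-mono-≤ (count-anyBelow n missHighBulk n) (count-anyBelow n missHighEdge A)))))
    where
    not-true : ∀ {b} → not b ≡ true → b ≡ false
    not-true {false} _ = refl

  τ₁ τ₄ κL κR : ℕ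
  τ₁ = marked (memberAt L) (suc c)
  τ₄ = marked (λ v → memberAt R₀ (A + v)) (suc c)
  κL = marked (memberAt L) ℓ
  κR = marked (memberAt R₀) ℓ

  term-by-avoid : ∀ τ (Miss Good : Subset n → Bool) → (∀ M → Miss M ≡ true → Good M ≡ true) →
    2 ^ τ * countSubsets n Good ≡ N → countSubsets n Miss * 2 ^ τ ≤ N
  term-by-avoid τ Miss Good forced count = ≤-trans (*-monoˡ-≤ (2 ^ τ) (count-mono n Miss Good forced))
    (≤-reflexive (trans (*-comm (countSubsets n Good) (2 ^ τ)) count))

  term-by-mirror : ∀ k κ (Miss Good : Subset n → Bool) → (∀ M → Miss M ≡ true → Good M ≡ true) →
    2 ^ k * (2 ^ κ * countSubsets n Good) ≡ mirrorWeight k * N →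
    2 ^ k * (2 ^ κ * countSubsets n Miss) ≤ mirrorWeight k * N
  term-by-mirror k κ Miss Good forced count =
    ≤-trans (*-monoʳ-≤ (2 ^ k) (*-monoʳ-≤ (2 ^ κ) (count-mono n Miss Good forced))) (≤-reflexive count)

  S₁ S₄ : ℕ
  S₁ = missing-count A missLowEdge
  S₄ = missing-count A missHighEdge

  edge-low : S₁ * 2 ^ τ₁ ≤ A * N
  edge-low = sumBelow-bound _ A (2 ^ τ₁) N (λ j j<A →
    term-by-avoid τ₁ (missLowEdge j) (LowEdgeGood j) (LowEdgeGood-forced j j<A ℓ≤n) (count-LowEdgeGood j j<A ℓ≤n))

  edge-high : S₄ * 2 ^ τ₄ ≤ A * N
  edge-high = sumBelow-bound _ A (2 ^ τ₄) N (λ j j<A →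
    term-by-avoid τ₄ (missHighEdge j) (HighEdgeGood j) (HighEdgeGood-forced j j<A ℓ≤n) (count-HighEdgeGood j j<A ℓ≤n))

  -- Bulk terms: the first m + 1 use both constraints, the remaining ones only the mirror pairs.
  S₂ S₂′ S₃ S₃′ : ℕ
  S₂ = missing-count (suc m) missLowBulk
  S₂′ = sumBelow (λ t → countSubsets n (missLowBulk (suc m + t))) ℓ
  S₃ = missing-count (suc m) missHighBulk
  S₃′ = sumBelow (λ t → countSubsets n (missHighBulk (suc m + t))) (c + A)

  low-bulk-split : missing-count (suc n) missLowBulk ≡ S₂ + S₂′
  low-bulk-split = trans (cong (λ z → missing-count (suc z) missLowBulk) n≡m+ℓ) (sumBelow-split _ (suc m) ℓ)

  high-bulk-split : missing-count n missHighBulk ≡ S₃ + S₃′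
  high-bulk-split = trans (cong (λ z → missing-count z missHighBulk) n≡suc-m+c+A) (sumBelow-split _ (suc m) (c + A))

  head-fits : ∀ k → k < suc m → k + ℓ ≤ n
  head-fits k k≤m = ≤-trans (+-monoˡ-≤ ℓ (≤-pred k≤m)) (≤-reflexive (sym n≡m+ℓ))

  bulk-low : S₂ * 2 ^ κL ≤ 6 * N
  bulk-low = ≤-trans (≤-reflexive (*-comm S₂ (2 ^ κL))) (geometric-bound _ (2 ^ κL) N (suc m) (λ k k≤m →
    term-by-mirror k κL (missLowBulk k) (LowBulkGood k) (LowBulkGood-forced k (head-fits k k≤m)) (count-LowBulkGood k (head-fits k k≤m))))

  bulk-high : S₃ * 2 ^ κR ≤ 6 * N
  bulk-high = ≤-trans (≤-reflexive (*-comm S₃ (2 ^ κR))) (geometric-bound _ (2 ^ κR) N (suc m) (λ k k≤m →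
    term-by-mirror k κR (missHighBulk k) (HighBulkGood k) (HighBulkGood-forced k (head-fits k k≤m)) (count-HighBulkGood k (head-fits k k≤m))))

  tail-exponent : ∀ t → h + h ≤ suc m + t
  tail-exponent t = ≤-trans 2h≤m (≤-trans (n≤1+n m) (m≤m+n (suc m) t))

  term-by-pairs : ∀ k (Miss Good : Subset n → Bool) → (∀ M → Miss M ≡ true → Good M ≡ true) →
    2 ^ k * countSubsets n Good ≡ mirrorWeight k * N → 2 ^ k * countSubsets n Miss ≤ mirrorWeight k * N
  term-by-pairs k Miss Good forced count = ≤-trans (*-monoʳ-≤ (2 ^ k) (count-mono n Miss Good forced)) (≤-reflexive count)

  tail-low : S₂′ * Q ≤ ℓ * N
  tail-low = sumBelow-bound _ ℓ Q N (λ t t<ℓ → tail-term-bound _ (suc m + t) h Q N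
    (term-by-pairs (suc m + t) (missLowBulk (suc m + t)) (LowBulkPairs (suc m + t))
       (LowBulkPairs-forced (suc m + t) (fits t t<ℓ)) (count-LowBulkPairs (suc m + t) (fits t t<ℓ)))
    (tail-exponent t) decay)
    where
    fits : ∀ t → t < ℓ → suc m + t ≤ n
    fits t t<ℓ = ≤-trans (≤-reflexive (sym (+-suc m t))) (≤-trans (+-monoʳ-≤ m t<ℓ) (≤-reflexive (sym n≡m+ℓ)))

  tail-high : S₃′ * Q ≤ (c + A) * N
  tail-high = sumBelow-bound _ (c + A) Q N (λ t t< → tail-term-bound _ (suc m + t) h Q N
    (term-by-pairs (suc m + t) (missHighBulk (suc m + t)) (HighBulkPairs (suc m + t))
       (HighBulkPairs-forced (suc m + t) (fits t t<)) (count-HighBulkPairs (suc m + t) (fits t t<)))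
    (tail-exponent t) decay)
    where
    fits : ∀ t → t < c + A → suc m + t ≤ n
    fits t t< = ≤-trans (+-monoʳ-≤ (suc m) (<⇒≤ t<)) (≤-reflexive (sym n≡suc-m+c+A))

  tails : (S₂′ + S₃′) * suc D ≤ 1 * N
  tails = *-cancelʳ-≤ ((S₂′ + S₃′) * suc D) (1 * N) (ℓ + ℓ) {{ℕ.>-nonZero (≤-trans 1≤ℓ (m≤m+n ℓ ℓ))}} (begin
    (S₂′ + S₃′) * suc D * (ℓ + ℓ)     ≡⟨ regroup (S₂′ + S₃′) (suc D) (ℓ + ℓ) ⟩
    (S₂′ + S₃′) * Q                   ≡⟨ *-distribʳ-+ Q S₂′ S₃′ ⟩
    S₂′ * Q + S₃′ * Q                 ≤⟨ +-mono-≤ tail-low tail-high ⟩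
    ℓ * N + (c + A) * N               ≡⟨ *-distribʳ-+ N ℓ (c + A) ⟨
    (ℓ + (c + A)) * N                 ≤⟨ *-monoˡ-≤ N (+-monoʳ-≤ ℓ (≤-trans (m≤m+n (c + A) 1) (≤-reflexive (sym ℓ≡)))) ⟩
    (ℓ + ℓ) * N                       ≡⟨ regroup′ N (ℓ + ℓ) ⟩
    1 * N * (ℓ + ℓ)                   ∎)
    where
    open ≤-Reasoning
    regroup : ∀ S d l → S * d * l ≡ S * (l * d)
    regroup = solve-∀
    regroup′ : ∀ N l → l * N ≡ 1 * N * l
    regroup′ = solve-∀

  failures-split : failures ≤ S₁ + S₂ + S₃ + S₄ + (S₂′ + S₃′)
  failures-split = ≤-trans union-bound (≤-reflexive (trans (cong₂ (λ u v → (S₁ + u) + (v + S₄)) low-bulk-split high-bulk-split)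
    (rearrange S₁ S₂ S₂′ S₃ S₃′ S₄)))
    where
    rearrange : ∀ a b c d e f → (a + (b + c)) + ((d + e) + f) ≡ a + b + d + f + (c + e)
    rearrange = solve-∀

  estimate : (ε : ℚ) → (+ 1) / suc D ≤ℚ ε → Bound a ε ≤ℚ ProbEvent a
  estimate ε D≤ε = subst (_≤ℚ ProbEvent a) (sym bound≡)
    (ProbabilityBound.probability-bound n good failures S₁ S₂ S₃ S₄ (S₂′ + S₃′) A τ₁ τ₄ κL κR D ε
       good+failures failures-split edge-low bulk-low bulk-high edge-high tails D≤ε)
    where
    bound≡ : Bound a ε ≡ 1ℚ ℚ.- toℚ (+ A) ℚ.* (pow2neg τ₄ ℚ.+ pow2neg τ₁) ℚ.- toℚ (+ 6) ℚ.* (pow2neg κL ℚ.+ pow2neg κR) ℚ.- ε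
    bound≡ = trans
      (cong₂ (λ u v → 1ℚ ℚ.- toℚ (+ A) ℚ.* (pow2neg (τR a) ℚ.+ pow2neg (τL a)) ℚ.- toℚ (+ 6) ℚ.* (pow2neg u ℚ.+ pow2neg v) ℚ.- ε)
             (card-marked L) (card-marked R₀))
      (cong₂ (λ y z → 1ℚ ℚ.- toℚ (+ A) ℚ.* (pow2neg y ℚ.+ pow2neg z) ℚ.- toℚ (+ 6) ℚ.* (pow2neg κL ℚ.+ pow2neg κR) ℚ.- ε)
             τR≡ τL≡)

-- Lemma B.2.  Choose D with 1/(D+1) ≤ ε and h = 3Q with Q = 2ℓ(D+1), so that
-- (3/4)^h ≤ 1/Q; then r₀ = 3ℓ + 2h leaves a middle block of size n ≥ ℓ + 2h, and the
-- minimal a has the form A + 2 required by the estimate.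
lemmaB2 : (ℓ : ℕ) → 1 ≤ ℓ → (L R₀ : Subset ℓ) → (ε : ℚ) → 0ℚ <ℚ ε →
  ∃[ r₀ ] (∀ (r : ℕ) → r₀ ≤ r → 2 * ℓ < r → (a : ℤ) → Setting.IsSmallestA ℓ L R₀ r a →
    Setting.Bound ℓ L R₀ r a ε ≤ℚ Setting.ProbEvent ℓ L R₀ r a)
lemmaB2 (suc ℓ′) 1≤ℓ L R₀ ε 0<ε = r₀ , bound
  where
  ℓ D Q h r₀ : ℕ
  ℓ = suc ℓ′
  D = proj₁ (unit-fraction-below ε 0<ε)
  Q = (ℓ + ℓ) * suc D
  h = 3 * Q
  r₀ = 2 * ℓ + (ℓ + (h + h))
  bound : ∀ r → r₀ ≤ r → 2 * ℓ < r → (a : ℤ) → Setting.IsSmallestA ℓ L R₀ r a →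
    Setting.Bound ℓ L R₀ r a ε ≤ℚ Setting.ProbEvent ℓ L R₀ r a
  bound r r₀≤r 2ℓ<r a smallest = for-A (SmallestA.smallest-a ℓ′ L R₀ r a smallest)
    where
    n-large : ℓ + (h + h) ≤ r ∸ 2 * ℓ
    n-large = ≤-trans (≤-reflexive (sym (m+n∸m≡n (2 * ℓ) (ℓ + (h + h))))) (∸-monoˡ-≤ (2 * ℓ) r₀≤r)
    for-A : (∃ λ A → a ≡ + suc (suc A) × A + 1 ≤ ℓ) → Setting.Bound ℓ L R₀ r a ε ≤ℚ Setting.ProbEvent ℓ L R₀ r a
    for-A (A , a≡A+2 , A+1≤ℓ) = subst (λ x → Setting.Bound ℓ L R₀ r x ε ≤ℚ Setting.ProbEvent ℓ L R₀ r x) (sym a≡A+2)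
      (Estimate.estimate ℓ 1≤ℓ L R₀ r (<⇒≤ 2ℓ<r) A (ℓ ∸ (A + 1)) ℓ≡ D h (power-decay Q) n-large ε
                         (proj₂ (unit-fraction-below ε 0<ε)))
      where
      ℓ≡ : ℓ ≡ ℓ ∸ (A + 1) + A + 1
      ℓ≡ = trans (sym (m∸n+n≡m A+1≤ℓ)) (sym (+-assoc (ℓ ∸ (A + 1)) A 1))
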